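{- For all positive integers $n,r$, \[\sum_{k=0}^r\mathcal{C}_k(q)\sum_{m=0}^{r-k}(1-q)^m\binom{n-2k-m}{r-k-m}\binom{k+m}{m}=\binom{n+1}{r}.\]
   Context: $q$ is an indeterminate. The Narayana polynomials are $C_0(q)=1$ and $C_n(q)=\sum_{k=1}^n \frac1n\binom{n}{k-1}\binom{n}{k}q^{k-1}$ for $n\ge1$; the large Narayana polynomials are $\mathcal{C}_0(q)=1$ and $\mathcal{C}_n(q)=q\,C_n(q)$ for $n\ge1$. Binomial coefficients $\binom{x}{k}$ with integer $k\ge0$ and arbitrary (possibly negative) integer $x$ mean $x(x-1)\cdots(x-k+1)/k!$. -}

module Defs where

open import Level using (Level)
open import Data.Nat as ℕ using (ℕ; zero; suc; _!)
open import Data.Nat.Combinatorics using (_C_)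
open import Data.Nat.Properties using (_!≢0)
open import Data.Integer as ℤ using (ℤ; +_; -[1+_]; _/ℕ_)
open import Algebra.Bundles using (CommutativeRing)

-- Generalised binomial coefficient (x choose k) for x ∈ ℤ, k ∈ ℕ:
-- x(x-1)…(x-k+1)/k!  (the division is exact).
fallingℤ : ℤ → ℕ → ℤ
fallingℤ x zero    = + 1
fallingℤ x (suc k) = fallingℤ x k ℤ.* (x ℤ.- + k)

binomℤ : ℤ → ℕ → ℤ
binomℤ x k = (fallingℤ x k /ℕ (k !)) {{k !≢0}}

-- Narayana number N(n,k) = (1/n) (n choose k-1) (n choose k), for n ≥ 1, 1 ≤ k ≤ n
-- (division is exact). Only used with n ≥ 1.
narayanaCoeff : ℕ → ℕ → ℕ
narayanaCoeff zero    k = 0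
narayanaCoeff (suc n) k = ((suc n C (k ℕ.∸ 1)) ℕ.* (suc n C k)) ℕ./ suc n

module InRing {c ℓ : Level} (R : CommutativeRing c ℓ) where
  open CommutativeRing R

  fromℕ : ℕ → Carrier
  fromℕ zero    = 0#
  fromℕ (suc n) = 1# + fromℕ n

  fromℤ : ℤ → Carrier
  fromℤ (+ n)    = fromℕ n
  fromℤ -[1+ n ] = - fromℕ (suc n)

  _^_ : Carrier → ℕ → Carrier
  x ^ zero  = 1#
  x ^ suc n = x * (x ^ n)

  sumFrom0 : ℕ → (ℕ → Carrier) → Carrier
  sumFrom0 zero    f = f 0
  sumFrom0 (suc n) f = sumFrom0 n f + f (suc n)

  sumFrom1 : ℕ → (ℕ → Carrier) → Carrier
  sumFrom1 zero    f = 0#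
  sumFrom1 (suc n) f = sumFrom1 n f + f (suc n)

  narayana : Carrier → ℕ → Carrier
  narayana q zero    = 1#
  narayana q (suc n) = sumFrom1 (suc n) (λ k → fromℕ (narayanaCoeff (suc n) k) * (q ^ (k ℕ.∸ 1)))

  largeNarayana : Carrier → ℕ → Carrier
  largeNarayana q zero    = 1#
  largeNarayana q (suc n) = q * narayana q (suc n)

module Submission where

-- Proof by generating functions in a variable w.  Put Φ(z) = ((1+qw)(1+w))^z for z ∈ ℤ
-- and t = w/Φ(1), so that t^k = w^k Φ(−k).
-- 1. Writing 1 + qw = (1+w) − (1−q)w, the binomial theorem and Vandermonde's identity
--    for integer exponents give: inner sum = [w^(r−k)] (1+qw)^−(k+1) (1+w)^(n+1−k)
--    = [w^r] t^k H, where H = (1+qw)^−1 (1+w)^(n+1).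
-- 2. Lagrange inversion: the unitriangular matrix A with columns t^k has inverse
--    B i k = [w^(i−k)] (1−qw²) Φ(i−1).  B·A = I comes down to [w^d] (1−qw²) Φ(d−1) = [d = 0],
--    a palindromy of the coefficients of Φ(N); A·B = I then follows by triangularity.
-- 3. B (k+1) 1 = [w^k] (1−qw²) Φ(k) = C_(k+1)(q), because the Narayana numbers are the
--    minors C(k,b)² − C(k,b−1) C(k,b+1).  With A·B = I this gives Σ_k 𝒞_k(q) t^k = 1 + qw.
-- 4. Hence the left side is [w^r] (1+qw) H = [w^r] (1+w)^(n+1) = C(n+1, r).

open import Defs
open import Level using (Level)
open import Data.Nat as ℕ using (ℕ; _∸_; _≤_)
open import Data.Nat using (zero; suc)
open import Data.Nat.Combinatorics using (_C_)
open import Data.Integer as ℤ using (+_)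
open import Algebra.Bundles using (CommutativeRing)

-- Arithmetic of binomial coefficients over ℕ, including the Narayana numbers as minors.
module BinomialArithmetic where

  open import Data.Nat
  open import Data.Nat.Properties
  open import Data.Nat.Combinatorics
  open import Data.Nat.DivMod using (_/_; m/n*n≡m; m*n/n≡m; n/n≡1)
  open import Data.Nat.Tactic.RingSolver using (solve-∀)
  open import Relation.Binary.PropositionalEquality
  open import Relation.Nullary using (yes; no)
  open import Defs using (narayanaCoeff)
  open ≡-Reasoning

  C-factorials : ∀ {n k} → k ≤ n → (n C k) * (k ! * (n ∸ k) !) ≡ n !
  C-factorials {n} {k} k≤n =
    trans (cong (_* (k ! * (n ∸ k) !)) (nCk≡n!/k![n-k]! k≤n))
          (m/n*n≡m {{k !* (n ∸ k) !≢0}} (k![n∸k]!∣n! k≤n))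

  C-factorials-+ : ∀ a b → ((a + b) C a) * (a ! * b !) ≡ (a + b) !
  C-factorials-+ a b =
    subst (λ t → ((a + b) C a) * (a ! * t !) ≡ (a + b) !) (m+n∸m≡n a b) (C-factorials (m≤m+n a b))

  C-factorials-+ʳ : ∀ a b → ((a + b) C b) * (a ! * b !) ≡ (a + b) !
  C-factorials-+ʳ a b = begin
    ((a + b) C b) * (a ! * b !) ≡⟨ cong₂ (λ s t → (s C b) * t) (+-comm a b) (*-comm (a !) (b !)) ⟩
    ((b + a) C b) * (b ! * a !) ≡⟨ C-factorials-+ b a ⟩
    (b + a) !                   ≡⟨ cong _! (+-comm b a) ⟩
    (a + b) !                   ∎

  absorption : ∀ N k → suc k * (suc N C suc k) ≡ suc N * (N C k)
  absorption N k with k ≤? N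
  ... | yes k≤N = subst (λ t → suc k * (suc t C suc k) ≡ suc t * (t C k)) (m+[n∸m]≡n k≤N) (split (N ∸ k))
    where
    -- both sides times k!·d! equal (k+d+1)!
    split : ∀ d → suc k * (suc (k + d) C suc k) ≡ suc (k + d) * ((k + d) C k)
    split d = *-cancelʳ-≡ _ _ (k ! * d !) {{k !* d !≢0}} (begin
      suc k * X * (k ! * d !)          ≡⟨ regroup (suc k) X (k !) (d !) ⟩
      X * ((suc k * k !) * d !)        ≡⟨ C-factorials-+ (suc k) d ⟩
      suc (k + d) * (k + d) !          ≡⟨ cong (suc (k + d) *_) (C-factorials-+ k d) ⟨
      suc (k + d) * (Y * (k ! * d !))  ≡⟨ *-assoc (suc (k + d)) Y _ ⟨
      suc (k + d) * Y * (k ! * d !)    ∎)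
      where
      X = suc (k + d) C suc k
      Y = (k + d) C k
      regroup : ∀ a x f g → a * x * (f * g) ≡ x * ((a * f) * g)
      regroup = solve-∀
  ... | no k≰N = begin
    suc k * (suc N C suc k) ≡⟨ cong (suc k *_) (k>n⇒nCk≡0 (s≤s (≰⇒> k≰N))) ⟩
    suc k * 0               ≡⟨ *-zeroʳ (suc k) ⟩
    0                       ≡⟨ *-zeroʳ (suc N) ⟨
    suc N * 0               ≡⟨ cong (suc N *_) (k>n⇒nCk≡0 (≰⇒> k≰N)) ⟨
    suc N * (N C k)         ∎

  C-suc-ratio : ∀ n k → suc k * (n C suc k) ≡ (n ∸ k) * (n C k)
  C-suc-ratio n k with k ≤? n
  ... | no k≰n = begin
    suc k * (n C suc k) ≡⟨ cong (suc k *_) (k>n⇒nCk≡0 (m<n⇒m<1+n (≰⇒> k≰n))) ⟩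
    suc k * 0           ≡⟨ *-zeroʳ (suc k) ⟩
    0                   ≡⟨ cong (_* (n C k)) (m≤n⇒m∸n≡0 (<⇒≤ (≰⇒> k≰n))) ⟨
    (n ∸ k) * (n C k)   ∎
  ... | yes k≤n = +-cancelˡ-≡ (suc k * (n C k)) _ _ (begin
    suc k * (n C k) + suc k * (n C suc k) ≡⟨ *-distribˡ-+ (suc k) (n C k) (n C suc k) ⟨
    suc k * ((n C k) + (n C suc k))       ≡⟨ cong (suc k *_) (nCk+nC[k+1]≡[n+1]C[k+1] n k) ⟩
    suc k * (suc n C suc k)               ≡⟨ absorption n k ⟩
    suc n * (n C k)                       ≡⟨ cong (λ t → suc t * (n C k)) (m+[n∸m]≡n k≤n) ⟨
    (suc k + (n ∸ k)) * (n C k)           ≡⟨ *-distribʳ-+ (n C k) (suc k) (n ∸ k) ⟩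
    suc k * (n C k) + (n ∸ k) * (n C k)   ∎)

  -- Trinomial revision: C(k+m,m)·C(k+u,u-m) = C(k+u,u)·C(u,m) for m ≤ u;
  -- both count splittings of k+u objects into blocks of sizes k, m, u-m.
  trinomial-revision : ∀ k {m u} → m ≤ u → ((k + m) C m) * ((k + u) C (u ∸ m)) ≡ ((k + u) C u) * (u C m)
  trinomial-revision k {m} {u} m≤u =
    subst (λ t → ((k + m) C m) * ((k + t) C (u ∸ m)) ≡ ((k + t) C t) * (t C m)) (m+[n∸m]≡n m≤u) (split (u ∸ m))
    where
    -- both sides times k!·m!·d! equal (k+m+d)!
    split : ∀ d → ((k + m) C m) * ((k + (m + d)) C d) ≡ ((k + (m + d)) C (m + d)) * ((m + d) C m)
    split d = *-cancelʳ-≡ _ _ (k ! * (m ! * d !)) {{m*n≢0 (k !) (m ! * d !) {{k !≢0}} {{m !* d !≢0}}}} (begin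
      A * B * (k ! * (m ! * d !))           ≡⟨ regroupˡ A B (k !) (m !) (d !) ⟩
      (A * (k ! * m !)) * (B * d !)         ≡⟨ cong (_* (B * d !)) (C-factorials-+ʳ k m) ⟩
      (k + m) ! * (B * d !)                 ≡⟨ regroupᵐ ((k + m) !) B (d !) ⟩
      B * ((k + m) ! * d !)                 ≡⟨ cong (λ t → (t C d) * ((k + m) ! * d !)) (+-assoc k m d) ⟨
      ((k + m + d) C d) * ((k + m) ! * d !) ≡⟨ C-factorials-+ʳ (k + m) d ⟩
      (k + m + d) !                         ≡⟨ cong _! (+-assoc k m d) ⟩
      (k + (m + d)) !                       ≡⟨ C-factorials-+ʳ k (m + d) ⟨
      D * (k ! * (m + d) !)                 ≡⟨ cong (λ t → D * (k ! * t)) (C-factorials-+ m d) ⟨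
      D * (k ! * (E * (m ! * d !)))         ≡⟨ regroupʳ D (k !) E (m ! * d !) ⟩
      D * E * (k ! * (m ! * d !))           ∎)
      where
      A = (k + m) C m
      B = (k + (m + d)) C d
      D = (k + (m + d)) C (m + d)
      E = (m + d) C m
      regroupˡ : ∀ a b x y z → a * b * (x * (y * z)) ≡ (a * (x * y)) * (b * z)
      regroupˡ = solve-∀
      regroupᵐ : ∀ a b c → a * (b * c) ≡ b * (a * c)
      regroupᵐ = solve-∀
      regroupʳ : ∀ a b c d → a * (b * (c * d)) ≡ a * c * (b * d)
      regroupʳ = solve-∀

  -- The polynomial identity behind the Narayana numbers: if a, x, c are three
  -- consecutive entries C(M,b), C(M,b+1), C(M,b+2) of row M = b+d+1 (encoded by
  -- the two ratio relations), then (M+1)x² = (a+x)(x+c) + (M+1)ac.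
  -- Multiplying by (d+1)(b+2) turns it into a polynomial identity in b, d, a, x.
  row-identity : ∀ b d a x c → suc b * x ≡ suc d * a → suc (suc b) * c ≡ d * x →
                 suc (suc (b + d)) * (x * x) ≡ (a + x) * (x + c) + suc (suc (b + d)) * (a * c)
  row-identity b d a x c ratio₁ ratio₂ = *-cancelˡ-≡ _ _ (suc d * suc (suc b)) (begin
    suc d * suc (suc b) * (suc (suc (b + d)) * (x * x))
      ≡⟨ expandˡ b d x ⟩
    (suc b * x) * (suc (suc b) * x) + (suc b * x) * (d * x) + suc d * suc (suc b) * (x * x)
      + (suc d * x) * (d * x) + suc (suc (b + d)) * ((suc b * x) * (d * x))
      ≡⟨ cong₂ (λ p s → p * (suc (suc b) * x) + p * s + suc d * suc (suc b) * (x * x) + (suc d * x) * s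
                        + suc (suc (b + d)) * (p * s)) ratio₁ (sym ratio₂) ⟩
    (suc d * a) * (suc (suc b) * x) + (suc d * a) * (suc (suc b) * c) + suc d * suc (suc b) * (x * x)
      + (suc d * x) * (suc (suc b) * c) + suc (suc (b + d)) * ((suc d * a) * (suc (suc b) * c))
      ≡⟨ expandʳ b d a x c ⟩
    suc d * suc (suc b) * ((a + x) * (x + c) + suc (suc (b + d)) * (a * c)) ∎)
    where
    expandˡ : ∀ b d x → suc d * suc (suc b) * (suc (suc (b + d)) * (x * x)) ≡
              (suc b * x) * (suc (suc b) * x) + (suc b * x) * (d * x) + suc d * suc (suc b) * (x * x)
              + (suc d * x) * (d * x) + suc (suc (b + d)) * ((suc b * x) * (d * x))
    expandˡ = solve-∀
    expandʳ : ∀ b d a x c →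
              (suc d * a) * (suc (suc b) * x) + (suc d * a) * (suc (suc b) * c) + suc d * suc (suc b) * (x * x)
              + (suc d * x) * (suc (suc b) * c) + suc (suc (b + d)) * ((suc d * a) * (suc (suc b) * c))
              ≡ suc d * suc (suc b) * ((a + x) * (x + c) + suc (suc (b + d)) * (a * c))
    expandʳ = solve-∀

  narayana-numerator : ∀ N b →
    (suc N C suc b) * (suc N C suc (suc b)) + suc N * ((N C b) * (N C suc (suc b)))
      ≡ suc N * ((N C suc b) * (N C suc b))
  narayana-numerator N b with suc b ≤? N
  ... | yes b<N = subst (λ M → (suc M C suc b) * (suc M C suc (suc b)) + suc M * ((M C b) * (M C suc (suc b)))
                              ≡ suc M * ((M C suc b) * (M C suc b)))
                        (m+[n∸m]≡n b<N) (inRow (N ∸ suc b))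
    where
    inRow : ∀ d → let M = suc (b + d) in
      (suc M C suc b) * (suc M C suc (suc b)) + suc M * ((M C b) * (M C suc (suc b)))
        ≡ suc M * ((M C suc b) * (M C suc b))
    inRow d = sym (trans (row-identity b d a x c ratio₁ ratio₂)
                         (cong₂ (λ s t → s * t + suc M * (a * c))
                                (nCk+nC[k+1]≡[n+1]C[k+1] M b) (nCk+nC[k+1]≡[n+1]C[k+1] M (suc b))))
      where
      M = suc (b + d)
      a = M C b
      x = M C suc b
      c = M C suc (suc b)
      ratio₁ : suc b * x ≡ suc d * a
      ratio₁ = trans (C-suc-ratio M b) (cong (_* a) (trans (+-∸-assoc 1 (m≤m+n b d)) (cong suc (m+n∸m≡n b d))))
      ratio₂ : suc (suc b) * c ≡ d * x
      ratio₂ = trans (C-suc-ratio M (suc b)) (cong (_* x) (m+n∸m≡n b d))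
  ... | no b≮N = begin
    (suc N C suc b) * (suc N C suc (suc b)) + suc N * ((N C b) * (N C suc (suc b)))
      ≡⟨ cong₂ (λ s t → (suc N C suc b) * s + suc N * ((N C b) * t)) (k>n⇒nCk≡0 (s≤s N<b+1)) (k>n⇒nCk≡0 (m<n⇒m<1+n N<b+1)) ⟩
    (suc N C suc b) * 0 + suc N * ((N C b) * 0)
      ≡⟨ vanish (suc N C suc b) (suc N) (N C b) ⟩
    suc N * (0 * 0)
      ≡⟨ cong (λ t → suc N * (t * t)) (k>n⇒nCk≡0 N<b+1) ⟨
    suc N * ((N C suc b) * (N C suc b)) ∎
    where
    N<b+1 : N < suc b
    N<b+1 = ≰⇒> b≮N
    vanish : ∀ p s a → p * 0 + s * (a * 0) ≡ s * (0 * 0)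
    vanish = solve-∀

  -- C(N,b−1)·C(N,b+1), read as 0 for b = 0.
  minorCorrection : ℕ → ℕ → ℕ
  minorCorrection N zero    = 0
  minorCorrection N (suc b) = (N C b) * (N C suc (suc b))

  -- The Narayana numbers as 2×2 minors of Pascal's triangle:
  -- N(N+1,b+1) = C(N,b)² − C(N,b−1)·C(N,b+1), written additively.
  narayana-minor : ∀ N b → narayanaCoeff (suc N) (suc b) + minorCorrection N b ≡ (N C b) * (N C b)
  narayana-minor N zero = begin
    (suc N C 0) * (suc N C 1) / suc N + 0 ≡⟨ +-identityʳ _ ⟩
    (suc N C 0) * (suc N C 1) / suc N     ≡⟨ cong (λ t → (1 * t) / suc N) (nC1≡n (suc N)) ⟩
    (1 * suc N) / suc N                   ≡⟨ cong (_/ suc N) (*-identityˡ (suc N)) ⟩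
    suc N / suc N                         ≡⟨ n/n≡1 (suc N) ⟩
    1                                     ∎
  narayana-minor N (suc b) = trans (cong (_+ ac) quotient) (m∸n+n≡m ac≤xx)
    where
    ac = (N C b) * (N C suc (suc b))
    xx = (N C suc b) * (N C suc b)
    Q = (suc N C suc b) * (suc N C suc (suc b))
    Q≡ : Q ≡ suc N * (xx ∸ ac)
    Q≡ = trans (sym (m+n∸n≡m Q (suc N * ac)))
               (trans (cong (_∸ suc N * ac) (narayana-numerator N b)) (sym (*-distribˡ-∸ (suc N) xx ac)))
    quotient : narayanaCoeff (suc N) (suc (suc b)) ≡ xx ∸ ac
    quotient = trans (cong (_/ suc N) (trans Q≡ (*-comm (suc N) _))) (m*n/n≡m (xx ∸ ac) (suc N))
    ac≤xx : ac ≤ xx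
    ac≤xx = *-cancelˡ-≤ (suc N) (subst (suc N * ac ≤_) (narayana-numerator N b) (m≤n+m (suc N * ac) Q))

module IntegerBinomial where

  open import Data.Nat as ℕ using (ℕ; zero; suc; _!; _∸_; _≤?_)
  import Data.Nat.Properties as ℕP
  open import Data.Nat.Combinatorics using (_C_; k>n⇒nCk≡0)
  open import Data.Nat.DivMod using (m*n/n≡m; m*n%n≡0)
  open import Data.Integer as ℤ using (ℤ; +_; -[1+_]; _/ℕ_)
  import Data.Integer.Properties as ℤP
  open import Data.Integer.Tactic.RingSolver using (solve-∀)
  open import Relation.Binary.PropositionalEquality
  open import Relation.Nullary using (yes; no)
  open import Defs using (fallingℤ; binomℤ)
  open BinomialArithmetic using (absorption; C-suc-ratio)
  open ≡-Reasoning

  sign : ℕ → ℤ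
  sign zero    = + 1
  sign (suc k) = ℤ.- sign k

  -- Closed form of the binomial coefficient with integer top:
  -- (n choose k) = C(n,k) and (-(n+1) choose k) = (-1)^k C(n+k,k).
  choose : ℤ → ℕ → ℤ
  choose (+ n)    k = + (n C k)
  choose -[1+ n ] k = sign k ℤ.* + ((n ℕ.+ k) C k)

  -- The recursion (x choose k)·(x-k) = (k+1)·(x choose k+1) that defines the
  -- falling factorial; for negative x it is absorption on row n+k+1.
  choose-step : ∀ x k → choose x k ℤ.* (x ℤ.- + k) ≡ + suc k ℤ.* choose x (suc k)
  choose-step (+ n) k with k ≤? n
  ... | yes k≤n = begin
    + (n C k) ℤ.* (+ n ℤ.- + k)   ≡⟨ cong (+ (n C k) ℤ.*_) (trans (ℤP.m-n≡m⊖n n k) (ℤP.⊖-≥ k≤n)) ⟩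
    + (n C k) ℤ.* + (n ∸ k)       ≡⟨ ℤP.pos-* (n C k) (n ∸ k) ⟨
    + ((n C k) ℕ.* (n ∸ k))       ≡⟨ cong +_ (trans (ℕP.*-comm (n C k) (n ∸ k)) (sym (C-suc-ratio n k))) ⟩
    + (suc k ℕ.* (n C suc k))     ≡⟨ ℤP.pos-* (suc k) (n C suc k) ⟩
    + suc k ℤ.* + (n C suc k)     ∎
  ... | no k≰n = begin
    + (n C k) ℤ.* (+ n ℤ.- + k)   ≡⟨ cong (λ t → + t ℤ.* (+ n ℤ.- + k)) (k>n⇒nCk≡0 (ℕP.≰⇒> k≰n)) ⟩
    + 0                           ≡⟨ ℤP.*-zeroʳ (+ suc k) ⟨
    + suc k ℤ.* + 0               ≡⟨ cong (λ t → + suc k ℤ.* + t) (k>n⇒nCk≡0 (ℕP.m<n⇒m<1+n (ℕP.≰⇒> k≰n))) ⟨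
    + suc k ℤ.* + (n C suc k)     ∎
  choose-step -[1+ n ] k = begin
    sign k ℤ.* + A ℤ.* (-[1+ n ] ℤ.- + k)        ≡⟨ cong (sign k ℤ.* + A ℤ.*_) top ⟩
    sign k ℤ.* + A ℤ.* (ℤ.- + suc (n ℕ.+ k))     ≡⟨ regroupˡ (sign k) (+ A) (+ suc (n ℕ.+ k)) ⟩
    ℤ.- (sign k ℤ.* (+ suc (n ℕ.+ k) ℤ.* + A))   ≡⟨ cong (λ t → ℤ.- (sign k ℤ.* t)) (trans (sym (ℤP.pos-* (suc (n ℕ.+ k)) A)) (cong +_ (sym absorb))) ⟩
    ℤ.- (sign k ℤ.* + (suc k ℕ.* B))             ≡⟨ cong (λ t → ℤ.- (sign k ℤ.* t)) (ℤP.pos-* (suc k) B) ⟩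
    ℤ.- (sign k ℤ.* (+ suc k ℤ.* + B))           ≡⟨ regroupʳ (sign k) (+ suc k) (+ B) ⟩
    + suc k ℤ.* (ℤ.- sign k ℤ.* + B)             ∎
    where
    A = (n ℕ.+ k) C k
    B = (n ℕ.+ suc k) C suc k
    top : -[1+ n ] ℤ.- + k ≡ ℤ.- + suc (n ℕ.+ k)
    top = trans (sym (ℤP.neg-distrib-+ (+ suc n) (+ k))) (cong ℤ.-_ (sym (ℤP.pos-+ (suc n) k)))
    absorb : suc k ℕ.* B ≡ suc (n ℕ.+ k) ℕ.* A
    absorb = trans (cong (λ t → suc k ℕ.* (t C suc k)) (ℕP.+-suc n k)) (absorption (n ℕ.+ k) k)
    regroupˡ : ∀ s c N → s ℤ.* c ℤ.* (ℤ.- N) ≡ ℤ.- (s ℤ.* (N ℤ.* c))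
    regroupˡ = solve-∀
    regroupʳ : ∀ s K c → ℤ.- (s ℤ.* (K ℤ.* c)) ≡ K ℤ.* (ℤ.- s ℤ.* c)
    regroupʳ = solve-∀

  falling-factorial : ∀ x k → fallingℤ x k ≡ + (k !) ℤ.* choose x k
  falling-factorial (+ n)    zero = refl
  falling-factorial -[1+ n ] zero = refl
  falling-factorial x (suc k) = begin
    fallingℤ x k ℤ.* (x ℤ.- + k)                 ≡⟨ cong (ℤ._* (x ℤ.- + k)) (falling-factorial x k) ⟩
    + (k !) ℤ.* choose x k ℤ.* (x ℤ.- + k)       ≡⟨ ℤP.*-assoc (+ (k !)) (choose x k) _ ⟩
    + (k !) ℤ.* (choose x k ℤ.* (x ℤ.- + k))     ≡⟨ cong (+ (k !) ℤ.*_) (choose-step x k) ⟩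
    + (k !) ℤ.* (+ suc k ℤ.* choose x (suc k))   ≡⟨ ℤP.*-assoc (+ (k !)) (+ suc k) _ ⟨
    + (k !) ℤ.* + suc k ℤ.* choose x (suc k)     ≡⟨ cong (ℤ._* choose x (suc k)) (trans (sym (ℤP.pos-* (k !) (suc k))) (cong +_ (ℕP.*-comm (k !) (suc k)))) ⟩
    + (suc k !) ℤ.* choose x (suc k)             ∎

  *-/ℕ-cancel : ∀ d b .{{_ : ℕ.NonZero d}} → ((+ d) ℤ.* b) /ℕ d ≡ b
  *-/ℕ-cancel d (+ m) =
    trans (cong (_/ℕ d) (sym (ℤP.pos-* d m))) (cong +_ (trans (cong (ℕ._/ d) (ℕP.*-comm d m)) (m*n/n≡m m d)))
  *-/ℕ-cancel (suc d) -[1+ m ] =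
    trans (negative (m ℕ.+ d ℕ.* suc m) (trans (cong (ℕ._% suc d) (ℕP.*-comm (suc d) (suc m))) (m*n%n≡0 (suc m) (suc d))))
          (cong (λ t → ℤ.- (+ t)) (trans (cong (ℕ._/ suc d) (ℕP.*-comm (suc d) (suc m))) (m*n/n≡m (suc m) (suc d))))
    where
    negative : ∀ X → suc X ℕ.% suc d ≡ 0 → -[1+ X ] /ℕ suc d ≡ ℤ.- (+ (suc X ℕ./ suc d))
    negative X divides with suc X ℕ.% suc d | divides
    ... | .0 | refl = refl

  binomℤ≡choose : ∀ x k → binomℤ x k ≡ choose x k
  binomℤ≡choose x k =
    trans (cong (λ t → (t /ℕ (k !)) {{ℕP._!≢0 k}}) (falling-factorial x k)) (*-/ℕ-cancel (k !) (choose x k) {{ℕP._!≢0 k}})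

module FiniteSums {c ℓ : Level} (R : CommutativeRing c ℓ) where

  open import Data.Nat as ℕ using (ℕ; zero; suc; _∸_; _≤_; _<_; z≤n; s≤s)
  open import Data.Nat.Properties as ℕP using (m≤n⇒m≤1+n; m≤n⇒m<n∨m≡n; ≤-refl)
  open import Data.Sum using (inj₁; inj₂)
  open import Relation.Binary.PropositionalEquality as ≡ using (_≡_)
  open import Defs using (module InRing)
  open CommutativeRing R hiding (zero)
  open InRing R using (sumFrom0)
  open import Relation.Binary.Reasoning.Setoid setoid

  Σ : ℕ → (ℕ → Carrier) → Carrier
  Σ = sumFrom0

  ≡⇒≈ : ∀ {x y} → x ≡ y → x ≈ y
  ≡⇒≈ ≡.refl = refl

  Σ-cong≤ : ∀ n {f g} → (∀ i → i ≤ n → f i ≈ g i) → Σ n f ≈ Σ n g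
  Σ-cong≤ zero    f≈g = f≈g 0 z≤n
  Σ-cong≤ (suc n) f≈g = +-cong (Σ-cong≤ n (λ i i≤n → f≈g i (m≤n⇒m≤1+n i≤n))) (f≈g (suc n) ≤-refl)

  Σ-cong : ∀ n {f g} → (∀ i → f i ≈ g i) → Σ n f ≈ Σ n g
  Σ-cong n f≈g = Σ-cong≤ n (λ i _ → f≈g i)

  Σ-zero : ∀ n f → (∀ i → i ≤ n → f i ≈ 0#) → Σ n f ≈ 0#
  Σ-zero n f f≈0 = trans (Σ-cong≤ n f≈0) (zeros n)
    where
    zeros : ∀ n → Σ n (λ _ → 0#) ≈ 0#
    zeros zero    = refl
    zeros (suc n) = trans (+-congʳ (zeros n)) (+-identityˡ 0#)

  Σ-+ : ∀ n f g → Σ n (λ i → f i + g i) ≈ Σ n f + Σ n g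
  Σ-+ zero    f g = refl
  Σ-+ (suc n) f g = begin
    Σ n (λ i → f i + g i) + (f (suc n) + g (suc n)) ≈⟨ +-congʳ (Σ-+ n f g) ⟩
    (Σ n f + Σ n g) + (f (suc n) + g (suc n))       ≈⟨ +-assoc _ _ _ ⟩
    Σ n f + (Σ n g + (f (suc n) + g (suc n)))       ≈⟨ +-congˡ (x+[y+z]≈y+[x+z] _ _ _) ⟩
    Σ n f + (f (suc n) + (Σ n g + g (suc n)))       ≈⟨ +-assoc _ _ _ ⟨
    (Σ n f + f (suc n)) + (Σ n g + g (suc n))       ∎
    where
    x+[y+z]≈y+[x+z] : ∀ x y z → x + (y + z) ≈ y + (x + z)
    x+[y+z]≈y+[x+z] x y z = trans (sym (+-assoc x y z)) (trans (+-congʳ (+-comm x y)) (+-assoc y x z))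

  Σ-*ˡ : ∀ n a f → a * Σ n f ≈ Σ n (λ i → a * f i)
  Σ-*ˡ zero    a f = refl
  Σ-*ˡ (suc n) a f = trans (distribˡ a (Σ n f) (f (suc n))) (+-congʳ (Σ-*ˡ n a f))

  Σ-*ʳ : ∀ n a f → Σ n f * a ≈ Σ n (λ i → f i * a)
  Σ-*ʳ n a f = trans (*-comm (Σ n f) a) (trans (Σ-*ˡ n a f) (Σ-cong n (λ i → *-comm a (f i))))

  Σ-head : ∀ n f → Σ (suc n) f ≈ f 0 + Σ n (λ i → f (suc i))
  Σ-head zero    f = refl
  Σ-head (suc n) f = trans (+-congʳ (Σ-head n f)) (+-assoc _ _ _)

  Σ-swap : ∀ m n (f : ℕ → ℕ → Carrier) → Σ m (λ i → Σ n (f i)) ≈ Σ n (λ j → Σ m (λ i → f i j))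
  Σ-swap zero    n f = refl
  Σ-swap (suc m) n f = begin
    Σ m (λ i → Σ n (f i)) + Σ n (f (suc m))                    ≈⟨ +-congʳ (Σ-swap m n f) ⟩
    Σ n (λ j → Σ m (λ i → f i j)) + Σ n (f (suc m))            ≈⟨ Σ-+ n (λ j → Σ m (λ i → f i j)) (f (suc m)) ⟨
    Σ n (λ j → Σ (suc m) (λ i → f i j))                        ∎

  Σ-reverse : ∀ n f → Σ n f ≈ Σ n (λ i → f (n ∸ i))
  Σ-reverse zero    f = refl
  Σ-reverse (suc n) f = begin
    Σ n f + f (suc n)                   ≈⟨ +-comm _ _ ⟩
    f (suc n) + Σ n f                   ≈⟨ +-congˡ (Σ-reverse n f) ⟩
    f (suc n) + Σ n (λ i → f (n ∸ i))   ≈⟨ Σ-head n (λ i → f (suc n ∸ i)) ⟨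
    Σ (suc n) (λ i → f (suc n ∸ i))     ∎

  Σ-truncate : ∀ {i} M f → i ≤ M → (∀ k → i < k → k ≤ M → f k ≈ 0#) → Σ M f ≈ Σ i f
  Σ-truncate zero    f z≤n _ = refl
  Σ-truncate (suc M) f i≤1+M vanish with m≤n⇒m<n∨m≡n i≤1+M
  ... | inj₂ ≡.refl     = refl
  ... | inj₁ (s≤s i≤M) = trans (+-cong (Σ-truncate M f i≤M (λ k i<k k≤M → vanish k i<k (m≤n⇒m≤1+n k≤M)))
                                       (vanish (suc M) (s≤s i≤M) ≤-refl))
                               (+-identityʳ _)

  Σ-triangle : ∀ j (g : ℕ → ℕ → Carrier) →
               Σ j (λ u → Σ u (λ m → g m u)) ≈ Σ j (λ m → Σ (j ∸ m) (λ i → g m (m ℕ.+ i)))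
  Σ-triangle zero    g = refl
  Σ-triangle (suc j) g = begin
    Σ j (λ u → Σ u (λ m → g m u)) + (Σ j (λ m → g m (suc j)) + g (suc j) (suc j))
      ≈⟨ +-assoc _ _ _ ⟨
    (Σ j (λ u → Σ u (λ m → g m u)) + Σ j (λ m → g m (suc j))) + g (suc j) (suc j)
      ≈⟨ +-congʳ (+-congʳ (Σ-triangle j g)) ⟩
    (Σ j (λ m → Σ (j ∸ m) (λ i → g m (m ℕ.+ i))) + Σ j (λ m → g m (suc j))) + g (suc j) (suc j)
      ≈⟨ +-cong (Σ-+ j _ _) (≡⇒≈ (≡.cong (g (suc j)) (ℕP.+-identityʳ (suc j)))) ⟨
    Σ j (λ m → Σ (j ∸ m) (λ i → g m (m ℕ.+ i)) + g m (suc j)) + g (suc j) (suc j ℕ.+ 0)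
      ≈⟨ +-cong (Σ-cong≤ j extend) (≡⇒≈ (≡.cong (λ t → Σ t (λ i → g (suc j) (suc j ℕ.+ i))) (≡.sym (ℕP.n∸n≡0 j)))) ⟩
    Σ j (λ m → Σ (suc j ∸ m) (λ i → g m (m ℕ.+ i))) + Σ (suc j ∸ suc j) (λ i → g (suc j) (suc j ℕ.+ i))
      ∎
    where
    -- row m gains the new entry u = j+1
    extend : ∀ m → m ≤ j → Σ (j ∸ m) (λ i → g m (m ℕ.+ i)) + g m (suc j) ≈ Σ (suc j ∸ m) (λ i → g m (m ℕ.+ i))
    extend m m≤j = begin
      Σ (j ∸ m) (λ i → g m (m ℕ.+ i)) + g m (suc j)
        ≈⟨ +-congˡ (≡⇒≈ (≡.cong (g m) (≡.trans (≡.cong suc (≡.sym (ℕP.m+[n∸m]≡n m≤j))) (≡.sym (ℕP.+-suc m (j ∸ m)))))) ⟩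
      Σ (suc (j ∸ m)) (λ i → g m (m ℕ.+ i))
        ≡⟨ ≡.cong (λ t → Σ t (λ i → g m (m ℕ.+ i))) (ℕP.+-∸-assoc 1 m≤j) ⟨
      Σ (suc j ∸ m) (λ i → g m (m ℕ.+ i)) ∎

  Σ-reassociate : ∀ m n (a : ℕ → Carrier) (f : ℕ → ℕ → Carrier) (g : ℕ → Carrier) →
                  Σ m (λ l → a l * Σ n (λ k → f l k * g k)) ≈ Σ n (λ k → Σ m (λ l → a l * f l k) * g k)
  Σ-reassociate m n a f g = begin
    Σ m (λ l → a l * Σ n (λ k → f l k * g k))     ≈⟨ Σ-cong m (λ l → Σ-*ˡ n (a l) _) ⟩
    Σ m (λ l → Σ n (λ k → a l * (f l k * g k)))   ≈⟨ Σ-swap m n _ ⟩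
    Σ n (λ k → Σ m (λ l → a l * (f l k * g k)))   ≈⟨ Σ-cong n (λ k → Σ-cong m (λ l → sym (*-assoc _ _ _))) ⟩
    Σ n (λ k → Σ m (λ l → (a l * f l k) * g k))   ≈⟨ Σ-cong n (λ k → Σ-*ʳ m (g k) _) ⟨
    Σ n (λ k → Σ m (λ l → a l * f l k) * g k)     ∎

module PowerSeries {c ℓ : Level} (R : CommutativeRing c ℓ) where

  open import Data.Nat as ℕ using (ℕ; zero; suc; _∸_; _≤_; _<_; z≤n; s≤s)
  open import Data.Nat.Properties as ℕP using (m≤n⇒m<n∨m≡n; n≤1+n; ≤-trans)
  open import Data.Sum using (inj₁; inj₂)
  open import Relation.Binary.PropositionalEquality as ≡ using (_≡_)
  open CommutativeRing R hiding (zero)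
  open import Algebra.Properties.Group +-group using () renaming (∙-cancelˡ to +-cancelˡ)
  open FiniteSums R
  open import Relation.Binary.Reasoning.Setoid setoid

  -- A formal power series in w is its sequence of coefficients.
  Series : Set c
  Series = ℕ → Carrier

  infix 4 _≋_
  _≋_ : Series → Series → Set ℓ
  a ≋ b = ∀ s → a s ≈ b s

  ≋-sym : ∀ {a b} → a ≋ b → b ≋ a
  ≋-sym a≋b s = sym (a≋b s)

  ≋-trans : ∀ {a b d} → a ≋ b → b ≋ d → a ≋ d
  ≋-trans a≋b b≋d s = trans (a≋b s) (b≋d s)

  infixl 7 _⊛_
  _⊛_ : Series → Series → Series
  (a ⊛ b) s = Σ s (λ i → a i * b (s ∸ i))

  𝟙 : Series
  𝟙 zero    = 1#
  𝟙 (suc _) = 0#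

  ⊛-cong : ∀ {a a′ b b′} → a ≋ a′ → b ≋ b′ → a ⊛ b ≋ a′ ⊛ b′
  ⊛-cong a≋a′ b≋b′ s = Σ-cong s (λ i → *-cong (a≋a′ i) (b≋b′ (s ∸ i)))

  ⊛-congˡ : ∀ a {b b′} → b ≋ b′ → a ⊛ b ≋ a ⊛ b′
  ⊛-congˡ a = ⊛-cong {a} {a} (λ _ → refl)

  ⊛-congʳ : ∀ b {a a′} → a ≋ a′ → a ⊛ b ≋ a′ ⊛ b
  ⊛-congʳ b a≋a′ = ⊛-cong {b = b} {b} a≋a′ (λ _ → refl)

  ⊛-comm : ∀ a b → a ⊛ b ≋ b ⊛ a
  ⊛-comm a b s = begin
    Σ s (λ i → a i * b (s ∸ i))             ≈⟨ Σ-reverse s _ ⟩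
    Σ s (λ i → a (s ∸ i) * b (s ∸ (s ∸ i))) ≈⟨ Σ-cong≤ s (λ i i≤s → trans (*-comm _ _) (*-congʳ (≡⇒≈ (≡.cong b (ℕP.m∸[m∸n]≡n i≤s))))) ⟩
    Σ s (λ i → b i * a (s ∸ i))             ∎

  ⊛-assoc : ∀ a b d → (a ⊛ b) ⊛ d ≋ a ⊛ (b ⊛ d)
  ⊛-assoc a b d s = begin
    Σ s (λ u → Σ u (λ m → a m * b (u ∸ m)) * d (s ∸ u))
      ≈⟨ Σ-cong s (λ u → Σ-*ʳ u _ _) ⟩
    Σ s (λ u → Σ u (λ m → a m * b (u ∸ m) * d (s ∸ u)))
      ≈⟨ Σ-triangle s (λ m u → a m * b (u ∸ m) * d (s ∸ u)) ⟩
    Σ s (λ m → Σ (s ∸ m) (λ i → a m * b (m ℕ.+ i ∸ m) * d (s ∸ (m ℕ.+ i))))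
      ≈⟨ Σ-cong s (λ m → Σ-cong (s ∸ m) (λ i → trans (*-assoc _ _ _)
           (*-congˡ (*-cong (≡⇒≈ (≡.cong b (ℕP.m+n∸m≡n m i))) (≡⇒≈ (≡.cong d (≡.sym (ℕP.∸-+-assoc s m i)))))))) ⟩
    Σ s (λ m → Σ (s ∸ m) (λ i → a m * (b i * d (s ∸ m ∸ i))))
      ≈⟨ Σ-cong s (λ m → Σ-*ˡ (s ∸ m) _ _) ⟨
    Σ s (λ m → a m * Σ (s ∸ m) (λ i → b i * d (s ∸ m ∸ i))) ∎

  ⊛-identityˡ : ∀ a → 𝟙 ⊛ a ≋ a
  ⊛-identityˡ a zero    = *-identityˡ (a 0)
  ⊛-identityˡ a (suc s) = begin
    (𝟙 ⊛ a) (suc s)                                 ≈⟨ Σ-head s _ ⟩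
    1# * a (suc s) + Σ s (λ i → 0# * a (s ∸ i))     ≈⟨ +-cong (*-identityˡ _) (Σ-zero s _ (λ i _ → zeroˡ _)) ⟩
    a (suc s) + 0#                                  ≈⟨ +-identityʳ _ ⟩
    a (suc s)                                       ∎

  ⊛-identityʳ : ∀ a → a ⊛ 𝟙 ≋ a
  ⊛-identityʳ a = ≋-trans (⊛-comm a 𝟙) (⊛-identityˡ a)

  ⊛-swap : ∀ a b d → a ⊛ (b ⊛ d) ≋ b ⊛ (a ⊛ d)
  ⊛-swap a b d = ≋-trans (≋-sym (⊛-assoc a b d)) (≋-trans (⊛-congʳ d (⊛-comm a b)) (⊛-assoc b a d))

  ⊛-medial : ∀ a b x y → (a ⊛ b) ⊛ (x ⊛ y) ≋ (a ⊛ x) ⊛ (b ⊛ y)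
  ⊛-medial a b x y = ≋-trans (⊛-assoc a b (x ⊛ y)) (≋-trans (⊛-congˡ a (⊛-swap b x y)) (≋-sym (⊛-assoc a x (b ⊛ y))))

  ⊛-last : ∀ a b s → (a ⊛ b) (suc s) ≈ Σ s (λ i → a i * b (suc s ∸ i)) + a (suc s) * b 0
  ⊛-last a b s = +-congˡ (*-congˡ (≡⇒≈ (≡.cong b (ℕP.n∸n≡0 s))))

  shift : ℕ → Series → Series
  shift zero    f s       = f s
  shift (suc j) f zero    = 0#
  shift (suc j) f (suc s) = shift j f s

  shift-below : ∀ {j s} f → j ≤ s → shift j f s ≡ f (s ∸ j)
  shift-below f z≤n       = ≡.refl
  shift-below f (s≤s j≤s) = shift-below f j≤s

  shift-above : ∀ {j s} f → s < j → shift j f s ≡ 0#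
  shift-above {suc j} {zero}  f _         = ≡.refl
  shift-above {suc j} {suc s} f (s≤s s<j) = shift-above f s<j

  shift-cong-at : ∀ j s {f g} → (j ≤ s → f (s ∸ j) ≈ g (s ∸ j)) → shift j f s ≈ shift j g s
  shift-cong-at zero    s       agree = agree z≤n
  shift-cong-at (suc j) zero    agree = refl
  shift-cong-at (suc j) (suc s) agree = shift-cong-at j s (λ j≤s → agree (s≤s j≤s))

  shift-⊛ : ∀ j g f → shift j g ⊛ f ≋ shift j (g ⊛ f)
  shift-⊛ zero    g f s       = refl
  shift-⊛ (suc j) g f zero    = zeroˡ (f 0)
  shift-⊛ (suc j) g f (suc s) = begin
    (shift (suc j) g ⊛ f) (suc s)                          ≈⟨ Σ-head s _ ⟩
    0# * f (suc s) + Σ s (λ i → shift j g i * f (s ∸ i))   ≈⟨ +-congʳ (zeroˡ _) ⟩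
    0# + (shift j g ⊛ f) s                                 ≈⟨ +-identityˡ _ ⟩
    (shift j g ⊛ f) s                                      ≈⟨ shift-⊛ j g f s ⟩
    shift j (g ⊛ f) s                                      ∎

  -- A lower-triangular matrix whose row i is read off from a series f,
  -- B i k = [w^(i-k)] f, acts on a column X by Cauchy product.
  Σ-shift-column : ∀ {i} M f X → i ≤ M → Σ M (λ k → shift k f i * X k) ≈ (X ⊛ f) i
  Σ-shift-column {i} M f X i≤M = begin
    Σ M (λ k → shift k f i * X k)   ≈⟨ Σ-truncate M _ i≤M (λ k i<k _ → trans (*-congʳ (≡⇒≈ (shift-above f i<k))) (zeroˡ _)) ⟩
    Σ i (λ k → shift k f i * X k)   ≈⟨ Σ-cong≤ i (λ k k≤i → trans (*-congʳ (≡⇒≈ (shift-below f k≤i))) (*-comm _ _)) ⟩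
    (X ⊛ f) i                       ∎

  unitriangular-injective : ∀ (b : ℕ → Series) → (∀ i → b i 0 ≈ 1#) → ∀ M {X Y} →
                            (∀ i → i ≤ M → (X ⊛ b i) i ≈ (Y ⊛ b i) i) → ∀ i → i ≤ M → X i ≈ Y i
  unitriangular-injective b unit M {X} {Y} agree i i≤M = upTo i i≤M i ℕP.≤-refl
    where
    diagonal : ∀ i → X i * b i 0 ≈ Y i * b i 0 → X i ≈ Y i
    diagonal i eq = trans (sym (*-identityʳ _)) (trans (*-congˡ (sym (unit i))) (trans eq (trans (*-congˡ (unit i)) (*-identityʳ _))))
    upTo : ∀ i → i ≤ M → ∀ u → u ≤ i → X u ≈ Y u
    upTo zero    0≤M .zero z≤n = diagonal 0 (agree 0 0≤M)
    upTo (suc i) i<M u u≤1+i with m≤n⇒m<n∨m≡n u≤1+i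
    ... | inj₁ (s≤s u≤i) = upTo i (≤-trans (n≤1+n i) i<M) u u≤i
    ... | inj₂ ≡.refl    = diagonal (suc i) (+-cancelˡ _ _ _ (begin
      Σ i (λ u → X u * b (suc i) (suc i ∸ u)) + X (suc i) * b (suc i) 0
        ≈⟨ ⊛-last X (b (suc i)) i ⟨
      (X ⊛ b (suc i)) (suc i)
        ≈⟨ agree (suc i) i<M ⟩
      (Y ⊛ b (suc i)) (suc i)
        ≈⟨ ⊛-last Y (b (suc i)) i ⟩
      Σ i (λ u → Y u * b (suc i) (suc i ∸ u)) + Y (suc i) * b (suc i) 0
        ≈⟨ +-congʳ (Σ-cong≤ i (λ u u≤i → *-congʳ (sym (upTo i (≤-trans (n≤1+n i) i<M) u u≤i)))) ⟩
      Σ i (λ u → X u * b (suc i) (suc i ∸ u)) + Y (suc i) * b (suc i) 0 ∎))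

  Σ-⊛ : ∀ n (α : ℕ → Carrier) (F : ℕ → Series) h s →
        Σ n (λ m → α m * (F m ⊛ h) s) ≈ ((λ u → Σ n (λ m → α m * F m u)) ⊛ h) s
  Σ-⊛ n α F h s = Σ-reassociate n s α F (λ u → h (s ∸ u))

  ⊛-cong-upto : ∀ s {a a′} b → (∀ u → u ≤ s → a u ≈ a′ u) → (a ⊛ b) s ≈ (a′ ⊛ b) s
  ⊛-cong-upto s b a≈a′ = Σ-cong≤ s (λ u u≤s → *-congʳ (a≈a′ u u≤s))

module RingBinomials {c ℓ : Level} (R : CommutativeRing c ℓ) where

  open import Data.Nat as ℕ using (ℕ; zero; suc)
  import Data.Nat.Properties as ℕP
  open import Data.Nat.Combinatorics using (_C_; nCn≡1; nCk+nC[k+1]≡[n+1]C[k+1])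
  open import Data.Integer as ℤ using (ℤ; +_; -[1+_])
  import Data.Integer.Properties as ℤP
  open import Relation.Binary.PropositionalEquality as ≡ using (_≡_)
  open import Defs using (module InRing; binomℤ)
  open IntegerBinomial using (sign; choose; binomℤ≡choose)
  open CommutativeRing R hiding (zero)
  open InRing R
  open import Algebra.Properties.Ring ring using (-‿involutive; -1*x≈-x)
  open FiniteSums R using (≡⇒≈)
  open import Relation.Binary.Reasoning.Setoid setoid

  fromℕ-1 : fromℕ 1 ≈ 1#
  fromℕ-1 = +-identityʳ 1#

  fromℕ-+ : ∀ a b → fromℕ (a ℕ.+ b) ≈ fromℕ a + fromℕ b
  fromℕ-+ zero    b = sym (+-identityˡ _)
  fromℕ-+ (suc a) b = trans (+-congˡ (fromℕ-+ a b)) (sym (+-assoc _ _ _))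

  fromℕ-* : ∀ a b → fromℕ (a ℕ.* b) ≈ fromℕ a * fromℕ b
  fromℕ-* zero    b = sym (zeroˡ _)
  fromℕ-* (suc a) b = begin
    fromℕ (b ℕ.+ a ℕ.* b)              ≈⟨ fromℕ-+ b (a ℕ.* b) ⟩
    fromℕ b + fromℕ (a ℕ.* b)          ≈⟨ +-cong (sym (*-identityˡ _)) (fromℕ-* a b) ⟩
    1# * fromℕ b + fromℕ a * fromℕ b   ≈⟨ distribʳ _ _ _ ⟨
    (1# + fromℕ a) * fromℕ b           ∎

  1^n≈1 : ∀ n → 1# ^ n ≈ 1#
  1^n≈1 zero    = refl
  1^n≈1 (suc n) = trans (*-identityˡ _) (1^n≈1 n)

  signR : ℕ → Carrier
  signR k = (- 1#) ^ k

  fromℤ-sign : ∀ k c → fromℤ (sign k ℤ.* + c) ≈ signR k * fromℕ c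
  fromℤ-sign zero    c = trans (≡⇒≈ (≡.cong fromℤ (ℤP.*-identityˡ (+ c)))) (sym (*-identityˡ _))
  fromℤ-sign (suc k) c = begin
    fromℤ (ℤ.- sign k ℤ.* + c)     ≈⟨ ≡⇒≈ (≡.cong fromℤ (≡.sym (ℤP.neg-distribˡ-* (sign k) (+ c)))) ⟩
    fromℤ (ℤ.- (sign k ℤ.* + c))   ≈⟨ fromℤ-neg (sign k ℤ.* + c) ⟩
    - fromℤ (sign k ℤ.* + c)       ≈⟨ -‿cong (fromℤ-sign k c) ⟩
    - (signR k * fromℕ c)          ≈⟨ -1*x≈-x _ ⟨
    - 1# * (signR k * fromℕ c)     ≈⟨ *-assoc _ _ _ ⟨
    signR (suc k) * fromℕ c        ∎
    where
    fromℤ-neg : ∀ z → fromℤ (ℤ.- z) ≈ - fromℤ z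
    fromℤ-neg (+ zero)  = sym (trans (sym (+-identityˡ (- 0#))) (-‿inverseʳ 0#))
    fromℤ-neg (+ suc n) = refl
    fromℤ-neg -[1+ n ]  = sym (-‿involutive _)

  binomR : ℤ → ℕ → Carrier
  binomR (+ n)    k = fromℕ (n C k)
  binomR -[1+ n ] k = signR k * fromℕ ((n ℕ.+ k) C k)

  fromℤ-binomℤ : ∀ x k → fromℤ (binomℤ x k) ≈ binomR x k
  fromℤ-binomℤ x k = trans (≡⇒≈ (≡.cong fromℤ (binomℤ≡choose x k))) (image x)
    where
    image : ∀ x → fromℤ (choose x k) ≈ binomR x k
    image (+ n)    = refl
    image -[1+ n ] = fromℤ-sign k _

  binomR-0 : ∀ x → binomR x 0 ≈ 1#
  binomR-0 (+ n)    = fromℕ-1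
  binomR-0 -[1+ n ] = trans (*-identityˡ _) (trans (≡⇒≈ (≡.cong (λ t → fromℕ (t C 0)) (ℕP.+-identityʳ n))) fromℕ-1)

  -- Successor on ℤ by cases, matching the two shapes of binomR.
  sucℤ : ℤ → ℤ
  sucℤ (+ n)          = + suc n
  sucℤ -[1+ zero ]    = + 0
  sucℤ -[1+ suc n ]   = -[1+ n ]

  sucℤ≡suc : ∀ x → sucℤ x ≡ ℤ.suc x
  sucℤ≡suc (+ n)        = ≡.refl
  sucℤ≡suc -[1+ zero ]  = ≡.refl
  sucℤ≡suc -[1+ suc n ] = ≡.refl

  alternating-step : ∀ u a b → (- 1# * u) * b ≈ (- 1# * u) * (a + b) + u * a
  alternating-step u a b = begin
    (- 1# * u) * b                                   ≈⟨ +-identityʳ _ ⟨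
    (- 1# * u) * b + 0#                              ≈⟨ +-congˡ (-‿inverseˡ (u * a)) ⟨
    (- 1# * u) * b + (- (u * a) + u * a)             ≈⟨ +-congˡ (+-congʳ (trans (sym (-1*x≈-x _)) (sym (*-assoc _ _ _)))) ⟩
    (- 1# * u) * b + ((- 1# * u) * a + u * a)        ≈⟨ +-assoc _ _ _ ⟨
    ((- 1# * u) * b + (- 1# * u) * a) + u * a        ≈⟨ +-congʳ (trans (+-comm _ _) (sym (distribˡ _ _ _))) ⟩
    (- 1# * u) * (a + b) + u * a                     ∎

  binomR-pascal : ∀ x s → binomR (sucℤ x) (suc s) ≈ binomR x (suc s) + binomR x s
  binomR-pascal (+ n) s = trans (≡⇒≈ (≡.cong fromℕ (≡.sym (nCk+nC[k+1]≡[n+1]C[k+1] n s))))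
                                (trans (fromℕ-+ (n C s) (n C suc s)) (+-comm _ _))
  binomR-pascal -[1+ zero ] s = begin
    0#                                              ≈⟨ -‿inverseˡ (signR s) ⟨
    - signR s + signR s                             ≈⟨ +-cong (trans (sym (-1*x≈-x _)) (sym (*-identityʳ _))) (sym (*-identityʳ _)) ⟩
    signR (suc s) * 1# + signR s * 1#               ≈⟨ +-cong (*-congˡ (one (suc s))) (*-congˡ (one s)) ⟨
    signR (suc s) * fromℕ (suc s C suc s) + signR s * fromℕ (s C s) ∎
    where
    one : ∀ k → fromℕ (k C k) ≈ 1#
    one k = trans (≡⇒≈ (≡.cong fromℕ (nCn≡1 k))) fromℕ-1
  binomR-pascal -[1+ suc n ] s = begin
    signR (suc s) * fromℕ ((n ℕ.+ suc s) C suc s)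
      ≈⟨ *-congˡ (≡⇒≈ (≡.cong (λ t → fromℕ (t C suc s)) (ℕP.+-suc n s))) ⟩
    signR (suc s) * fromℕ (M C suc s)
      ≈⟨ alternating-step (signR s) (fromℕ (M C s)) (fromℕ (M C suc s)) ⟩
    signR (suc s) * (fromℕ (M C s) + fromℕ (M C suc s)) + signR s * fromℕ (M C s)
      ≈⟨ +-congʳ (*-congˡ (trans (sym (fromℕ-+ (M C s) (M C suc s))) (≡⇒≈ (≡.cong fromℕ (nCk+nC[k+1]≡[n+1]C[k+1] M s))))) ⟩
    signR (suc s) * fromℕ (suc M C suc s) + signR s * fromℕ (M C s)
      ≈⟨ +-congʳ (*-congˡ (≡⇒≈ (≡.cong (λ t → fromℕ (t C suc s)) (≡.sym (ℕP.+-suc (suc n) s))))) ⟩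
    signR (suc s) * fromℕ ((suc n ℕ.+ suc s) C suc s) + signR s * fromℕ ((suc n ℕ.+ s) C s) ∎
    where
    M = suc n ℕ.+ s

-- The series (1 + aw)^z for z ∈ ℤ: Vandermonde's identity and a negative binomial expansion.
module BinomialSeries {c ℓ : Level} (R : CommutativeRing c ℓ) where

  open import Data.Nat as ℕ using (ℕ; zero; suc; _∸_; _≤_)
  import Data.Nat.Properties as ℕP
  open import Data.Nat.Combinatorics using (_C_)
  open import Data.Fin using (toℕ)
  open import Data.Integer as ℤ using (ℤ; +_; -[1+_])
  import Data.Integer.Properties as ℤP
  open import Data.Integer.Tactic.RingSolver using (solve-∀)
  open import Relation.Binary.PropositionalEquality as ≡ using (_≡_)
  open import Defs using (module InRing)
  open BinomialArithmetic using (trinomial-revision)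
  open CommutativeRing R hiding (zero)
  open InRing R
  open import Algebra.Properties.Ring ring using (-‿distribʳ-*)
  open import Algebra.Properties.Semiring.Exp semiring using () renaming (_^_ to _^ˢ_)
  open import Algebra.Properties.Semiring.Mult semiring using (_×_; ×-assoc-*; ×-congʳ)
  open import Algebra.Properties.Semiring.Sum semiring using (sum)
  import Algebra.Properties.Semiring.Binomial semiring as Binomial
  open import Algebra.Solver.Ring.NaturalCoefficients.Default commutativeSemiring using (solve; _:*_; _:=_)
  open FiniteSums R
  open PowerSeries R
  open RingBinomials R
  open import Relation.Binary.Reasoning.Setoid setoid

  binomial-theorem : ∀ x y u → Σ u (λ m → fromℕ (u C m) * (x ^ m * y ^ (u ∸ m))) ≈ (x + y) ^ u
  binomial-theorem x y u = begin
    Σ u (λ m → fromℕ (u C m) * (x ^ m * y ^ (u ∸ m)))   ≈⟨ Σ-cong u term ⟩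
    Σ u (λ m → (u C m) × (x ^ˢ m * y ^ˢ (u ∸ m)))       ≈⟨ Σ≈sum u _ ⟩
    Binomial.binomialExpansion x y u                    ≈⟨ Binomial.theorem x y (*-comm x y) u ⟨
    (x + y) ^ˢ u                                        ≈⟨ ^≈^ˢ (x + y) u ⟨
    (x + y) ^ u                                         ∎
    where
    ^≈^ˢ : ∀ x n → x ^ n ≈ x ^ˢ n
    ^≈^ˢ x zero    = refl
    ^≈^ˢ x (suc n) = *-congˡ (^≈^ˢ x n)
    fromℕ≈× : ∀ n → fromℕ n ≈ n × 1#
    fromℕ≈× zero    = refl
    fromℕ≈× (suc n) = +-congˡ (fromℕ≈× n)
    term : ∀ m → fromℕ (u C m) * (x ^ m * y ^ (u ∸ m)) ≈ (u C m) × (x ^ˢ m * y ^ˢ (u ∸ m))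
    term m = trans (*-cong (fromℕ≈× (u C m)) (*-cong (^≈^ˢ x m) (^≈^ˢ y (u ∸ m))))
                   (trans (×-assoc-* (u C m) 1# _) (×-congʳ (u C m) (*-identityˡ _)))
    Σ≈sum : ∀ n f → Σ n f ≈ sum {suc n} (λ k → f (toℕ k))
    Σ≈sum zero    f = sym (+-identityʳ (f 0))
    Σ≈sum (suc n) f = trans (Σ-head n f) (+-congˡ (Σ≈sum n (λ i → f (suc i))))

  [1+_w]^_ : Carrier → ℤ → Series
  [1+ a w]^ z = λ s → a ^ s * binomR z s

  [1+w]^-≡ : ∀ a {x y} → x ≡ y → [1+ a w]^ x ≋ [1+ a w]^ y
  [1+w]^-≡ a ≡.refl s = refl

  [1+w]^-constant : ∀ a z → ([1+ a w]^ z) 0 ≈ 1#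
  [1+w]^-constant a z = trans (*-identityˡ _) (binomR-0 z)

  [1+w]^0 : ∀ a → [1+ a w]^ (+ 0) ≋ 𝟙
  [1+w]^0 a zero    = [1+w]^-constant a (+ 0)
  [1+w]^0 a (suc s) = zeroʳ _

  [1+1w]^ : ∀ z s → ([1+ 1# w]^ z) s ≈ binomR z s
  [1+1w]^ z s = trans (*-congʳ (1^n≈1 s)) (*-identityˡ _)

  [1+w]^1-⊛ : ∀ a X s → ([1+ a w]^ (+ 1) ⊛ X) (suc s) ≈ X (suc s) + a * X s
  [1+w]^1-⊛ a X s = begin
    ([1+ a w]^ (+ 1) ⊛ X) (suc s)                                              ≈⟨ Σ-head s _ ⟩
    ([1+ a w]^ (+ 1)) 0 * X (suc s) + Σ s (λ i → ([1+ a w]^ (+ 1)) (suc i) * X (s ∸ i))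
      ≈⟨ +-cong (trans (*-congʳ ([1+w]^-constant a (+ 1))) (*-identityˡ _)) (tail s) ⟩
    X (suc s) + a * X s                                                        ∎
    where
    linear : ([1+ a w]^ (+ 1)) 1 ≈ a
    linear = trans (*-cong (*-identityʳ a) fromℕ-1) (*-identityʳ a)
    tail : ∀ s → Σ s (λ i → ([1+ a w]^ (+ 1)) (suc i) * X (s ∸ i)) ≈ a * X s
    tail zero    = *-congʳ linear
    tail (suc s) = begin
      Σ (suc s) (λ i → ([1+ a w]^ (+ 1)) (suc i) * X (suc s ∸ i))  ≈⟨ Σ-head s _ ⟩
      ([1+ a w]^ (+ 1)) 1 * X (suc s) + Σ s (λ i → (a ^ suc (suc i) * 0#) * X (s ∸ i))
        ≈⟨ +-cong (*-congʳ linear) (Σ-zero s _ (λ i _ → trans (*-congʳ (zeroʳ _)) (zeroˡ _))) ⟩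
      a * X (suc s) + 0#                                             ≈⟨ +-identityʳ _ ⟩
      a * X (suc s)                                                  ∎

  [1+w]^-suc : ∀ a z → [1+ a w]^ (sucℤ z) ≋ [1+ a w]^ (+ 1) ⊛ [1+ a w]^ z
  [1+w]^-suc a z zero = begin
    ([1+ a w]^ (sucℤ z)) 0   ≈⟨ [1+w]^-constant a (sucℤ z) ⟩
    1#                       ≈⟨ [1+w]^-constant a z ⟨
    ([1+ a w]^ z) 0          ≈⟨ *-identityˡ _ ⟨
    1# * ([1+ a w]^ z) 0     ≈⟨ *-congʳ ([1+w]^-constant a (+ 1)) ⟨
    ([1+ a w]^ (+ 1) ⊛ [1+ a w]^ z) 0 ∎
  [1+w]^-suc a z (suc s) = begin
    a ^ suc s * binomR (sucℤ z) (suc s)                        ≈⟨ *-congˡ (binomR-pascal z s) ⟩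
    a ^ suc s * (binomR z (suc s) + binomR z s)                ≈⟨ distribˡ _ _ _ ⟩
    a ^ suc s * binomR z (suc s) + (a * a ^ s) * binomR z s    ≈⟨ +-congˡ (*-assoc _ _ _) ⟩
    ([1+ a w]^ z) (suc s) + a * ([1+ a w]^ z) s                ≈⟨ [1+w]^1-⊛ a ([1+ a w]^ z) s ⟨
    ([1+ a w]^ (+ 1) ⊛ [1+ a w]^ z) (suc s)                    ∎

  -- 1 + a·w is not a zero divisor (its constant term is 1).
  [1+w]^1-cancel : ∀ a X Y → [1+ a w]^ (+ 1) ⊛ X ≋ [1+ a w]^ (+ 1) ⊛ Y → X ≋ Y
  [1+w]^1-cancel a X Y eq s =
    unitriangular-injective (λ _ → [1+ a w]^ (+ 1)) (λ _ → [1+w]^-constant a (+ 1)) s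
      (λ i _ → trans (⊛-comm X _ i) (trans (eq i) (⊛-comm _ Y i))) s ℕP.≤-refl

  ℤ-induction : ∀ {p} (P : ℤ → Set p) → P (+ 0) → (∀ z → P z → P (sucℤ z)) → (∀ z → P (sucℤ z) → P z) → ∀ z → P z
  ℤ-induction P base up down (+ zero)       = base
  ℤ-induction P base up down (+ suc n)      = up (+ n) (ℤ-induction P base up down (+ n))
  ℤ-induction P base up down -[1+ zero ]    = down -[1+ zero ] base
  ℤ-induction P base up down -[1+ suc n ]   = down -[1+ suc n ] (ℤ-induction P base up down -[1+ n ])

  +-sucℤ : ∀ x y → x ℤ.+ sucℤ y ≡ sucℤ (x ℤ.+ y)
  +-sucℤ x y = ≡.trans (≡.cong (λ t → x ℤ.+ t) (sucℤ≡suc y)) (≡.trans (shuffle x y) (≡.sym (sucℤ≡suc (x ℤ.+ y))))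
    where
    shuffle : ∀ x y → x ℤ.+ (+ 1 ℤ.+ y) ≡ + 1 ℤ.+ (x ℤ.+ y)
    shuffle = solve-∀

  [1+w]^-+ : ∀ a x y → [1+ a w]^ x ⊛ [1+ a w]^ y ≋ [1+ a w]^ (x ℤ.+ y)
  [1+w]^-+ a x = ℤ-induction (λ y → [1+ a w]^ x ⊛ [1+ a w]^ y ≋ [1+ a w]^ (x ℤ.+ y)) base up down
    where
    E = [1+_w]^_ a
    base : E x ⊛ E (+ 0) ≋ E (x ℤ.+ + 0)
    base = ≋-trans (⊛-congˡ (E x) ([1+w]^0 a)) (≋-trans (⊛-identityʳ (E x)) ([1+w]^-≡ a (≡.sym (ℤP.+-identityʳ x))))
    -- multiplying both sides by 1 + aw
    up : ∀ y → E x ⊛ E y ≋ E (x ℤ.+ y) → E x ⊛ E (sucℤ y) ≋ E (x ℤ.+ sucℤ y)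
    up y ih = ≋-trans (⊛-congˡ (E x) ([1+w]^-suc a y)) (≋-trans (⊛-swap (E x) (E (+ 1)) (E y))
               (≋-trans (⊛-congˡ (E (+ 1)) ih) (≋-trans (≋-sym ([1+w]^-suc a (x ℤ.+ y))) ([1+w]^-≡ a (≡.sym (+-sucℤ x y))))))
    -- cancelling 1 + aw from both sides
    down : ∀ y → E x ⊛ E (sucℤ y) ≋ E (x ℤ.+ sucℤ y) → E x ⊛ E y ≋ E (x ℤ.+ y)
    down y ih = [1+w]^1-cancel a _ _ (≋-trans (⊛-swap (E (+ 1)) (E x) (E y)) (≋-trans (⊛-congˡ (E x) (≋-sym ([1+w]^-suc a y)))
                  (≋-trans ih (≋-trans ([1+w]^-≡ a (+-sucℤ x y)) ([1+w]^-suc a (x ℤ.+ y))))))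

  -- Writing 1 + qw = (1 + w) − (1 − q)w and expanding:
  -- (1+qw)^-(k+1) = Σ_m C(k+m,m) ((1−q)w)^m (1+w)^-(k+m+1).
  negative-binomial-expansion : ∀ q k u →
    Σ u (λ m → ((1# - q) ^ m * fromℕ ((k ℕ.+ m) C m)) * binomR -[1+ k ℕ.+ m ] (u ∸ m)) ≈ ([1+ q w]^ -[1+ k ]) u
  negative-binomial-expansion q k u = begin
    Σ u (λ m → ((1# - q) ^ m * fromℕ ((k ℕ.+ m) C m)) * binomR -[1+ k ℕ.+ m ] (u ∸ m))
      ≈⟨ Σ-cong≤ u term ⟩
    Σ u (λ m → D * (fromℕ (u C m) * ((1# - q) ^ m * signR (u ∸ m))))
      ≈⟨ Σ-*ˡ u D _ ⟨
    D * Σ u (λ m → fromℕ (u C m) * ((1# - q) ^ m * signR (u ∸ m)))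
      ≈⟨ *-congˡ (binomial-theorem (1# - q) (- 1#) u) ⟩
    D * ((1# - q) + - 1#) ^ u
      ≈⟨ *-congˡ (^-congˡ (trans 1-q-1≈-q (-‿distribʳ-* q 1#)) u) ⟩
    D * (q * - 1#) ^ u
      ≈⟨ *-congˡ (^-distrib-* q (- 1#) u) ⟩
    D * (q ^ u * signR u)
      ≈⟨ rearrange D (q ^ u) (signR u) ⟩
    q ^ u * (signR u * D) ∎
    where
    D = fromℕ ((k ℕ.+ u) C u)
    ^-congˡ : ∀ {a b} → a ≈ b → ∀ u → a ^ u ≈ b ^ u
    ^-congˡ a≈b zero    = refl
    ^-congˡ a≈b (suc u) = *-cong a≈b (^-congˡ a≈b u)
    ^-distrib-* : ∀ a b u → (a * b) ^ u ≈ a ^ u * b ^ u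
    ^-distrib-* a b zero    = sym (*-identityˡ 1#)
    ^-distrib-* a b (suc u) = trans (*-congˡ (^-distrib-* a b u)) (solve 4 (λ a b x y → (a :* b) :* (x :* y) := (a :* x) :* (b :* y)) refl a b (a ^ u) (b ^ u))
    1-q-1≈-q : (1# - q) + - 1# ≈ - (q * 1#)
    1-q-1≈-q = begin
      (1# + - q) + - 1#   ≈⟨ +-assoc 1# (- q) (- 1#) ⟩
      1# + (- q + - 1#)   ≈⟨ +-congˡ (+-comm (- q) (- 1#)) ⟩
      1# + (- 1# + - q)   ≈⟨ +-assoc _ _ _ ⟨
      (1# + - 1#) + - q   ≈⟨ +-congʳ (-‿inverseʳ 1#) ⟩
      0# + - q            ≈⟨ +-identityˡ _ ⟩
      - q                 ≈⟨ -‿cong (*-identityʳ q) ⟨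
      - (q * 1#)          ∎
    rearrange : ∀ c a s → c * (a * s) ≈ a * (s * c)
    rearrange = solve 3 (λ c a s → c :* (a :* s) := a :* (s :* c)) refl
    -- C(k+m,m)·C(k+u,u−m) = C(k+u,u)·C(u,m)
    term : ∀ m → m ≤ u → ((1# - q) ^ m * fromℕ ((k ℕ.+ m) C m)) * binomR -[1+ k ℕ.+ m ] (u ∸ m)
                       ≈ D * (fromℕ (u C m) * ((1# - q) ^ m * signR (u ∸ m)))
    term m m≤u = begin
      ((1# - q) ^ m * fromℕ A) * (signR (u ∸ m) * fromℕ B)
        ≈⟨ regroup _ _ _ _ ⟩
      ((1# - q) ^ m * signR (u ∸ m)) * (fromℕ A * fromℕ B)
        ≈⟨ *-congˡ (fromℕ-* A B) ⟨
      ((1# - q) ^ m * signR (u ∸ m)) * fromℕ (A ℕ.* B)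
        ≈⟨ *-congˡ (≡⇒≈ (≡.cong fromℕ (≡.trans (≡.cong (λ t → A ℕ.* (t C (u ∸ m))) top) (trinomial-revision k m≤u)))) ⟩
      ((1# - q) ^ m * signR (u ∸ m)) * fromℕ (((k ℕ.+ u) C u) ℕ.* (u C m))
        ≈⟨ *-congˡ (fromℕ-* ((k ℕ.+ u) C u) (u C m)) ⟩
      ((1# - q) ^ m * signR (u ∸ m)) * (D * fromℕ (u C m))
        ≈⟨ regroup′ _ _ _ ⟩
      D * (fromℕ (u C m) * ((1# - q) ^ m * signR (u ∸ m))) ∎
      where
      A = (k ℕ.+ m) C m
      B = (k ℕ.+ m ℕ.+ (u ∸ m)) C (u ∸ m)
      top : k ℕ.+ m ℕ.+ (u ∸ m) ≡ k ℕ.+ u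
      top = ≡.trans (ℕP.+-assoc k m (u ∸ m)) (≡.cong (k ℕ.+_) (ℕP.m+[n∸m]≡n m≤u))
      regroup : ∀ a c s d → (a * c) * (s * d) ≈ (a * s) * (c * d)
      regroup = solve 4 (λ a c s d → (a :* c) :* (s :* d) := (a :* s) :* (c :* d)) refl
      regroup′ : ∀ p d c → p * (d * c) ≈ d * (c * p)
      regroup′ = solve 3 (λ p d c → p :* (d :* c) := d :* (c :* p)) refl

-- Φ(z) = ((1+qw)(1+w))^z, and the Narayana polynomials as coefficients of (1 − qw²)Φ(N).
module NarayanaSeries {c ℓ : Level} (R : CommutativeRing c ℓ) (q : CommutativeRing.Carrier R) where

  open import Data.Nat as ℕ using (ℕ; zero; suc; _∸_; _≤_; _<_; s≤s)
  import Data.Nat.Properties as ℕP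
  open import Data.Nat.Combinatorics using (_C_; k>n⇒nCk≡0; nCk≡nC[n∸k])
  open import Data.Integer as ℤ using (ℤ; +_)
  open import Relation.Binary.PropositionalEquality as ≡ using (_≡_)
  open import Defs using (module InRing; narayanaCoeff)
  open BinomialArithmetic using (minorCorrection; narayana-minor)
  open CommutativeRing R hiding (zero)
  open InRing R
  open import Algebra.Properties.Group +-group using () renaming (∙-cancelʳ to +-cancelʳ)
  open FiniteSums R
  open PowerSeries R
  open RingBinomials R
  open BinomialSeries R
  open import Relation.Binary.Reasoning.Setoid setoid

  Φ : ℤ → Series
  Φ z = [1+ q w]^ z ⊛ [1+ 1# w]^ z

  Φ-+ : ∀ x y → Φ x ⊛ Φ y ≋ Φ (x ℤ.+ y)
  Φ-+ x y = ≋-trans (⊛-medial ([1+ q w]^ x) ([1+ 1# w]^ x) ([1+ q w]^ y) ([1+ 1# w]^ y))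
                    (⊛-cong ([1+w]^-+ q x y) ([1+w]^-+ 1# x y))

  Φ-constant : ∀ z → Φ z 0 ≈ 1#
  Φ-constant z = trans (*-cong ([1+w]^-constant q z) ([1+w]^-constant 1# z)) (*-identityˡ 1#)

  Φ-coefficient : ∀ N s → Φ (+ N) s ≈ Σ s (λ i → fromℕ ((N C i) ℕ.* (N C (s ∸ i))) * q ^ i)
  Φ-coefficient N s = Σ-cong s (λ i → begin
    (q ^ i * fromℕ (N C i)) * ([1+ 1# w]^ (+ N)) (s ∸ i)   ≈⟨ *-congˡ ([1+1w]^ (+ N) (s ∸ i)) ⟩
    (q ^ i * fromℕ (N C i)) * fromℕ (N C (s ∸ i))          ≈⟨ *-congʳ (*-comm _ _) ⟩
    (fromℕ (N C i) * q ^ i) * fromℕ (N C (s ∸ i))          ≈⟨ *-assoc _ _ _ ⟩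
    fromℕ (N C i) * (q ^ i * fromℕ (N C (s ∸ i)))          ≈⟨ *-congˡ (*-comm _ _) ⟩
    fromℕ (N C i) * (fromℕ (N C (s ∸ i)) * q ^ i)          ≈⟨ *-assoc _ _ _ ⟨
    (fromℕ (N C i) * fromℕ (N C (s ∸ i))) * q ^ i          ≈⟨ *-congʳ (fromℕ-* (N C i) (N C (s ∸ i))) ⟨
    fromℕ ((N C i) ℕ.* (N C (s ∸ i))) * q ^ i              ∎)

  q*-polynomial : ∀ M (f : ℕ → ℕ) → q * Σ M (λ i → fromℕ (f i) * q ^ i) ≈ Σ M (λ i → fromℕ (f i) * q ^ suc i)
  q*-polynomial M f = trans (Σ-*ˡ M q _) (Σ-cong M (λ i → trans (sym (*-assoc _ _ _)) (trans (*-congʳ (*-comm _ _)) (*-assoc _ _ _))))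

  outside-rowˡ : ∀ {N k} a x → N < k → fromℕ ((N C k) ℕ.* a) * x ≈ 0#
  outside-rowˡ a x N<k = trans (*-congʳ (≡⇒≈ (≡.cong (λ t → fromℕ (t ℕ.* a)) (k>n⇒nCk≡0 N<k)))) (zeroˡ x)

  outside-rowʳ : ∀ {N k} a x → N < k → fromℕ (a ℕ.* (N C k)) * x ≈ 0#
  outside-rowʳ {N} {k} a x N<k = trans (*-congʳ (≡⇒≈ (≡.cong fromℕ (ℕP.*-comm a (N C k))))) (outside-rowˡ a x N<k)

  L : Series
  L zero                = 1#
  L (suc zero)          = 0#
  L (suc (suc zero))    = - q
  L (suc (suc (suc _))) = 0#

  L-⊛-0 : ∀ X → (L ⊛ X) 0 ≈ X 0
  L-⊛-0 X = *-identityˡ _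

  L-⊛-1 : ∀ X → (L ⊛ X) 1 ≈ X 1
  L-⊛-1 X = trans (+-cong (*-identityˡ _) (zeroˡ _)) (+-identityʳ _)

  L-⊛-2+ : ∀ X m → (L ⊛ X) (suc (suc m)) ≈ X (suc (suc m)) + - q * X m
  L-⊛-2+ X m = begin
    (L ⊛ X) (suc (suc m))                                                       ≈⟨ Σ-head (suc m) _ ⟩
    L 0 * X (suc (suc m)) + Σ (suc m) (λ i → L (suc i) * X (suc m ∸ i))         ≈⟨ +-cong (*-identityˡ _) (Σ-head m _) ⟩
    X (suc (suc m)) + (0# * X (suc m) + Σ m (λ i → L (suc (suc i)) * X (m ∸ i))) ≈⟨ +-congˡ (+-cong (zeroˡ _) (tail m)) ⟩
    X (suc (suc m)) + (0# + - q * X m)                                          ≈⟨ +-congˡ (+-identityˡ _) ⟩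
    X (suc (suc m)) + - q * X m                                                 ∎
    where
    tail : ∀ m → Σ m (λ i → L (suc (suc i)) * X (m ∸ i)) ≈ - q * X m
    tail zero    = refl
    tail (suc m) = trans (Σ-head m _) (trans (+-congˡ (Σ-zero m _ (λ i _ → zeroˡ _))) (+-identityʳ _))

  -q*x+q*x≈0 : ∀ x → - q * x + q * x ≈ 0#
  -q*x+q*x≈0 x = trans (sym (distribʳ x (- q) q)) (trans (*-congʳ (-‿inverseˡ q)) (zeroˡ x))

  -- Palindromy of Φ(N): [w^(N+1)] Φ(N) = q·[w^(N−1)] Φ(N) for N ≥ 1.
  Φ-beyond-middle : ∀ M → Φ (+ suc M) (suc (suc M)) ≈ q * Φ (+ suc M) M
  Φ-beyond-middle M = begin
    Φ (+ N) (suc N)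
      ≈⟨ trans (Φ-coefficient N (suc N)) (Σ-head N _) ⟩
    fromℕ ((N C 0) ℕ.* (N C suc N)) * q ^ 0 + Σ N (λ i → fromℕ ((N C suc i) ℕ.* (N C (N ∸ i))) * q ^ suc i)
      ≈⟨ +-cong (outside-rowʳ (N C 0) _ (ℕP.n<1+n N)) (+-congˡ (outside-rowˡ (N C (N ∸ N)) _ (ℕP.n<1+n N))) ⟩
    0# + (Σ M (λ i → fromℕ ((N C suc i) ℕ.* (N C (N ∸ i))) * q ^ suc i) + 0#)
      ≈⟨ trans (+-identityˡ _) (+-identityʳ _) ⟩
    Σ M (λ i → fromℕ ((N C suc i) ℕ.* (N C (N ∸ i))) * q ^ suc i)
      ≈⟨ Σ-cong≤ M (λ i i≤M → *-congʳ (≡⇒≈ (≡.cong fromℕ (mirror i i≤M)))) ⟩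
    Σ M (λ i → fromℕ ((N C i) ℕ.* (N C (M ∸ i))) * q ^ suc i)
      ≈⟨ q*-polynomial M (λ i → (N C i) ℕ.* (N C (M ∸ i))) ⟨
    q * Σ M (λ i → fromℕ ((N C i) ℕ.* (N C (M ∸ i))) * q ^ i)
      ≈⟨ *-congˡ (Φ-coefficient N M) ⟨
    q * Φ (+ N) M ∎
    where
    N = suc M
    mirror : ∀ i → i ≤ M → (N C suc i) ℕ.* (N C (N ∸ i)) ≡ (N C i) ℕ.* (N C (M ∸ i))
    mirror i i≤M = ≡.trans (≡.cong₂ ℕ._*_ (nCk≡nC[n∸k] (s≤s i≤M)) (≡.sym (nCk≡nC[n∸k] (ℕP.m≤n⇒m≤1+n i≤M))))
                           (ℕP.*-comm (N C (N ∸ suc i)) (N C i))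

  LΦ-beyond : ∀ N → (L ⊛ Φ (+ N)) (suc N) ≈ 0#
  LΦ-beyond zero    = trans (L-⊛-1 (Φ (+ 0))) (trans (Φ-coefficient 0 1) (trans (+-cong (zeroˡ _) (zeroˡ _)) (+-identityʳ 0#)))
  LΦ-beyond (suc M) = begin
    (L ⊛ Φ (+ suc M)) (suc (suc M))                  ≈⟨ L-⊛-2+ (Φ (+ suc M)) M ⟩
    Φ (+ suc M) (suc (suc M)) + - q * Φ (+ suc M) M  ≈⟨ +-congʳ (Φ-beyond-middle M) ⟩
    q * Φ (+ suc M) M + - q * Φ (+ suc M) M          ≈⟨ +-comm _ _ ⟩
    - q * Φ (+ suc M) M + q * Φ (+ suc M) M          ≈⟨ -q*x+q*x≈0 _ ⟩
    0#                                               ∎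

  correction : ℕ → Carrier
  correction N = Σ N (λ b → fromℕ (minorCorrection N b) * q ^ b)

  correction≈ : ∀ M → q * Φ (+ suc (suc M)) M ≈ correction (suc (suc M))
  correction≈ M = begin
    q * Φ (+ N) M
      ≈⟨ trans (*-congˡ (Φ-coefficient N M)) (q*-polynomial M (λ i → (N C i) ℕ.* (N C (M ∸ i)))) ⟩
    Σ M (λ i → fromℕ ((N C i) ℕ.* (N C (M ∸ i))) * q ^ suc i)
      ≈⟨ Σ-cong≤ M (λ i i≤M → *-congʳ (≡⇒≈ (≡.cong (λ t → fromℕ ((N C i) ℕ.* t)) (≡.sym (nCk≡nC[n∸k] (s≤s (s≤s i≤M))))))) ⟩
    Σ M (λ i → fromℕ (minorCorrection N (suc i)) * q ^ suc i)
      ≈⟨ +-identityʳ _ ⟨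
    Σ M (λ i → fromℕ (minorCorrection N (suc i)) * q ^ suc i) + 0#
      ≈⟨ +-congˡ (outside-rowʳ (N C suc M) _ (ℕP.n<1+n N)) ⟨
    Σ (suc M) (λ i → fromℕ (minorCorrection N (suc i)) * q ^ suc i)
      ≈⟨ trans (+-congʳ (zeroˡ _)) (+-identityˡ _) ⟨
    fromℕ (minorCorrection N 0) * q ^ 0 + Σ (suc M) (λ i → fromℕ (minorCorrection N (suc i)) * q ^ suc i)
      ≈⟨ Σ-head (suc M) _ ⟨
    correction N ∎
    where N = suc (suc M)

  LΦ+correction : ∀ N → (L ⊛ Φ (+ N)) N + correction N ≈ Φ (+ N) N
  LΦ+correction zero          = trans (+-cong (L-⊛-0 (Φ (+ 0))) (zeroˡ _)) (+-identityʳ _)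
  LΦ+correction (suc zero)    = trans (+-cong (L-⊛-1 (Φ (+ 1))) (trans (+-cong (zeroˡ _) (zeroˡ _)) (+-identityʳ 0#))) (+-identityʳ _)
  LΦ+correction (suc (suc M)) = begin
    (L ⊛ Φ (+ N)) N + correction N                        ≈⟨ +-cong (L-⊛-2+ (Φ (+ N)) M) (sym (correction≈ M)) ⟩
    (Φ (+ N) N + - q * Φ (+ N) M) + q * Φ (+ N) M         ≈⟨ +-assoc _ _ _ ⟩
    Φ (+ N) N + (- q * Φ (+ N) M + q * Φ (+ N) M)         ≈⟨ +-congˡ (-q*x+q*x≈0 _) ⟩
    Φ (+ N) N + 0#                                        ≈⟨ +-identityʳ _ ⟩
    Φ (+ N) N                                             ∎
    where N = suc (suc M)

  LΦ-diagonal : ∀ N → (L ⊛ Φ (+ N)) N ≈ narayana q (suc N)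
  LΦ-diagonal N = sym (trans (from1 N _) (+-cancelʳ (correction N) _ _ (begin
    narayanaSum + correction N
      ≈⟨ Σ-+ N _ _ ⟨
    Σ N (λ b → fromℕ (narayanaCoeff (suc N) (suc b)) * q ^ b + fromℕ (minorCorrection N b) * q ^ b)
      ≈⟨ Σ-cong N (λ b → trans (sym (distribʳ _ _ _)) (*-congʳ (trans (sym (fromℕ-+ (narayanaCoeff (suc N) (suc b)) (minorCorrection N b))) (≡⇒≈ (≡.cong fromℕ (narayana-minor N b)))))) ⟩
    Σ N (λ b → fromℕ ((N C b) ℕ.* (N C b)) * q ^ b)
      ≈⟨ Σ-cong≤ N (λ b b≤N → *-congʳ (≡⇒≈ (≡.cong (λ t → fromℕ ((N C b) ℕ.* t)) (nCk≡nC[n∸k] b≤N)))) ⟩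
    Σ N (λ b → fromℕ ((N C b) ℕ.* (N C (N ∸ b))) * q ^ b)
      ≈⟨ Φ-coefficient N N ⟨
    Φ (+ N) N
      ≈⟨ LΦ+correction N ⟨
    (L ⊛ Φ (+ N)) N + correction N ∎)))
    where
    narayanaSum = Σ N (λ b → fromℕ (narayanaCoeff (suc N) (suc b)) * q ^ b)
    from1 : ∀ n f → sumFrom1 (suc n) f ≈ Σ n (λ i → f (suc i))
    from1 zero    f = +-identityˡ _
    from1 (suc n) f = +-congʳ (from1 n f)

  LΦ-unit : ∀ d → (L ⊛ Φ (+ d ℤ.- + 1)) d ≈ 𝟙 d
  LΦ-unit zero    = trans (L-⊛-0 (Φ (+ 0 ℤ.- + 1))) (Φ-constant (+ 0 ℤ.- + 1))
  LΦ-unit (suc N) = LΦ-beyond N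

-- Lagrange inversion for t = w/Φ(1), and the generating function Σ_k 𝒞_k(q) t^k = 1 + qw.
module LagrangeInversion {c ℓ : Level} (R : CommutativeRing c ℓ) (q : CommutativeRing.Carrier R) where

  open import Data.Nat using (ℕ; zero; suc; _∸_; _≤_)
  open import Data.Integer as ℤ using (ℤ; +_)
  import Data.Integer.Properties as ℤP
  open import Data.Integer.Tactic.RingSolver using (solve-∀)
  open import Relation.Binary.PropositionalEquality as ≡ using (_≡_)
  open import Defs using (module InRing)
  open CommutativeRing R hiding (zero)
  open InRing R
  open FiniteSums R
  open PowerSeries R
  open RingBinomials R using (fromℕ-1)
  open BinomialSeries R
  open NarayanaSeries R q
  open import Relation.Binary.Reasoning.Setoid setoid

  -- t^k = w^k Φ(−k), where t = w / ((1 + qw)(1 + w)); column k of the matrix A.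
  tPower : ℕ → Series
  tPower k = shift k (Φ (ℤ.- (+ k)))

  -- Row i of the inverse matrix B: B i k = [w^(i−k)] (1 − qw²) Φ(i − 1).
  row : ℕ → Series
  row i = L ⊛ Φ (+ i ℤ.- + 1)

  B : ℕ → ℕ → Carrier
  B i k = shift k (row i) i

  row-constant : ∀ i → row i 0 ≈ 1#
  row-constant i = trans (L-⊛-0 (Φ (+ i ℤ.- + 1))) (Φ-constant (+ i ℤ.- + 1))

  -- Lagrange inversion, B·A = I: Σ_k B i k [w^k] t^j = [i = j].
  -- In series form: [w^i] t^j (1 − qw²) Φ(i−1) = [w^(i−j)] (1 − qw²) Φ(i−j−1).
  B-tPower : ∀ M i j → i ≤ M → Σ M (λ k → B i k * tPower j k) ≈ shift j 𝟙 i
  B-tPower M i j i≤M = begin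
    Σ M (λ k → B i k * tPower j k)              ≈⟨ Σ-shift-column M (row i) (tPower j) i≤M ⟩
    (shift j (Φ (ℤ.- (+ j))) ⊛ row i) i         ≈⟨ shift-⊛ j (Φ (ℤ.- (+ j))) (row i) i ⟩
    shift j (Φ (ℤ.- (+ j)) ⊛ row i) i           ≈⟨ shift-cong-at j i unit ⟩
    shift j 𝟙 i                                 ∎
    where
    exponent : j ≤ i → ℤ.- (+ j) ℤ.+ (+ i ℤ.- + 1) ≡ + (i ∸ j) ℤ.- + 1
    exponent j≤i = ≡.trans (shuffle (+ i) (+ j)) (≡.cong (ℤ._- + 1) (≡.trans (ℤP.m-n≡m⊖n i j) (ℤP.⊖-≥ j≤i)))
      where
      shuffle : ∀ x y → ℤ.- y ℤ.+ (x ℤ.- + 1) ≡ (x ℤ.- y) ℤ.- + 1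
      shuffle = solve-∀
    unit : j ≤ i → (Φ (ℤ.- (+ j)) ⊛ row i) (i ∸ j) ≈ 𝟙 (i ∸ j)
    unit j≤i = begin
      (Φ (ℤ.- (+ j)) ⊛ (L ⊛ Φ (+ i ℤ.- + 1))) (i ∸ j)    ≈⟨ ⊛-swap (Φ (ℤ.- (+ j))) L (Φ (+ i ℤ.- + 1)) (i ∸ j) ⟩
      (L ⊛ (Φ (ℤ.- (+ j)) ⊛ Φ (+ i ℤ.- + 1))) (i ∸ j)    ≈⟨ ⊛-congˡ L (Φ-+ (ℤ.- (+ j)) (+ i ℤ.- + 1)) (i ∸ j) ⟩
      (L ⊛ Φ (ℤ.- (+ j) ℤ.+ (+ i ℤ.- + 1))) (i ∸ j)      ≈⟨ ≡⇒≈ (≡.cong (λ z → (L ⊛ Φ z) (i ∸ j)) (exponent j≤i)) ⟩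
      (L ⊛ Φ (+ (i ∸ j) ℤ.- + 1)) (i ∸ j)                ≈⟨ LΦ-unit (i ∸ j) ⟩
      𝟙 (i ∸ j)                                          ∎

  -- A·B = I, from B·A = I because B is unitriangular:
  -- Σ_k [w^s] t^k · B k j = [s = j] for s ≤ M.
  tPower-B : ∀ M j s → s ≤ M → Σ M (λ k → tPower k s * B k j) ≈ shift j 𝟙 s
  tPower-B M j = unitriangular-injective row row-constant M agree
    where
    X : Series
    X s = Σ M (λ k → tPower k s * B k j)
    agree : ∀ i → i ≤ M → (X ⊛ row i) i ≈ (shift j 𝟙 ⊛ row i) i
    agree i i≤M = begin
      (X ⊛ row i) i                                    ≈⟨ Σ-shift-column M (row i) X i≤M ⟨
      Σ M (λ l → B i l * X l)                          ≈⟨ Σ-reassociate M M (B i) (λ l k → tPower k l) (λ k → B k j) ⟩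
      Σ M (λ k → Σ M (λ l → B i l * tPower k l) * B k j) ≈⟨ Σ-cong M (λ k → *-congʳ (B-tPower M i k i≤M)) ⟩
      Σ M (λ k → shift k 𝟙 i * B k j)                  ≈⟨ Σ-shift-column M 𝟙 (λ k → B k j) i≤M ⟩
      ((λ k → B k j) ⊛ 𝟙) i                            ≈⟨ ⊛-identityʳ (λ k → B k j) i ⟩
      shift j (row i) i                                ≈⟨ shift-cong-at j i (λ _ → sym (⊛-identityˡ (row i) (i ∸ j))) ⟩
      shift j (𝟙 ⊛ row i) i                            ≈⟨ shift-⊛ j 𝟙 (row i) i ⟨
      (shift j 𝟙 ⊛ row i) i                            ∎

  narayana-at-t : ∀ r s → s ≤ suc r → Σ (suc r) (λ k → largeNarayana q k * tPower k s) ≈ ([1+ q w]^ (+ 1)) s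
  narayana-at-t r s s≤1+r = begin
    Σ (suc r) (λ k → largeNarayana q k * tPower k s)
      ≈⟨ Σ-head r _ ⟩
    1# * tPower 0 s + Σ r (λ k → (q * narayana q (suc k)) * tPower (suc k) s)
      ≈⟨ +-cong (trans (*-identityˡ _) (Φ0 s)) (Σ-cong r (λ k → trans (regroup (narayana q (suc k)) (tPower (suc k) s)) (*-congˡ (*-congˡ (sym (LΦ-diagonal k)))))) ⟩
    𝟙 s + Σ r (λ k → q * (tPower (suc k) s * B (suc k) 1))
      ≈⟨ +-congˡ (Σ-*ˡ r q _) ⟨
    𝟙 s + q * Σ r (λ k → tPower (suc k) s * B (suc k) 1)
      ≈⟨ +-congˡ (*-congˡ (trans (+-congʳ (zeroʳ _)) (+-identityˡ _))) ⟨
    𝟙 s + q * (tPower 0 s * 0# + Σ r (λ k → tPower (suc k) s * B (suc k) 1))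
      ≈⟨ +-congˡ (*-congˡ (Σ-head r _)) ⟨
    𝟙 s + q * Σ (suc r) (λ k → tPower k s * B k 1)
      ≈⟨ +-congˡ (*-congˡ (tPower-B (suc r) 1 s s≤1+r)) ⟩
    𝟙 s + q * shift 1 𝟙 s
      ≈⟨ linear s ⟨
    ([1+ q w]^ (+ 1)) s ∎
    where
    Φ0 : Φ (+ 0) ≋ 𝟙
    Φ0 = ≋-trans (⊛-cong ([1+w]^0 q) ([1+w]^0 1#)) (⊛-identityˡ 𝟙)
    -- 𝒞_(k+1)(q) = q·C_(k+1)(q) = q·B (k+1) 1
    regroup : ∀ c x → (q * c) * x ≈ q * (x * c)
    regroup c x = trans (*-assoc q c x) (*-congˡ (*-comm c x))
    linear : ∀ s → ([1+ q w]^ (+ 1)) s ≈ 𝟙 s + q * shift 1 𝟙 s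
    linear zero          = trans ([1+w]^-constant q (+ 1)) (sym (trans (+-congˡ (zeroʳ q)) (+-identityʳ 1#)))
    linear (suc zero)    = trans (trans (*-cong (*-identityʳ q) fromℕ-1) (*-identityʳ q)) (sym (trans (+-identityˡ _) (*-identityʳ q)))
    linear (suc (suc s)) = trans (zeroʳ _) (sym (trans (+-identityˡ _) (zeroʳ q)))

-- The inner sum of the theorem as a coefficient of t^k (1+qw)^−1 (1+w)^(n+1).
module InnerSum {c ℓ : Level} (R : CommutativeRing c ℓ) (q : CommutativeRing.Carrier R) (n : ℕ) where

  open import Data.Nat as ℕ using (suc; _∸_; _≤_)
  import Data.Nat.Properties as ℕP
  open import Data.Nat.Combinatorics using (_C_)
  open import Data.Integer as ℤ using (ℤ; +_; -[1+_])
  import Data.Integer.Properties as ℤP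
  open import Data.Integer.Tactic.RingSolver using (solve-∀)
  open import Relation.Binary.PropositionalEquality as ≡ using (_≡_)
  open import Defs using (module InRing; binomℤ)
  open CommutativeRing R
  open InRing R
  open FiniteSums R
  open PowerSeries R
  open RingBinomials R
  open BinomialSeries R
  open NarayanaSeries R q using (Φ)
  open LagrangeInversion R q using (tPower)
  open import Relation.Binary.Reasoning.Setoid setoid

  innerSum : ℕ → ℕ → Carrier
  innerSum k j = Σ j (λ m → ((1# - q) ^ m) *
                   (fromℤ (binomℤ (+ n ℤ.- + (2 ℕ.* k ℕ.+ m)) (j ∸ m)) * fromℕ ((k ℕ.+ m) C m)))

  innerSum-coefficient : ∀ k j → innerSum k j ≈ ([1+ q w]^ -[1+ k ] ⊛ [1+ 1# w]^ (+ suc n ℤ.- + k)) j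
  innerSum-coefficient k j = begin
    innerSum k j                                        ≈⟨ Σ-cong≤ j term ⟩
    Σ j (λ m → α m * (shift m (g m) ⊛ h) j)             ≈⟨ Σ-⊛ j α (λ m → shift m (g m)) h j ⟩
    ((λ u → Σ j (λ m → α m * shift m (g m) u)) ⊛ h) j   ≈⟨ ⊛-cong-upto j h collapse ⟩
    ([1+ q w]^ -[1+ k ] ⊛ h) j                          ∎
    where
    α : ℕ → Carrier
    α m = (1# - q) ^ m * fromℕ ((k ℕ.+ m) C m)
    g : ℕ → Series
    g m = [1+ 1# w]^ -[1+ k ℕ.+ m ]
    h : Series
    h = [1+ 1# w]^ (+ suc n ℤ.- + k)
    exponent : ∀ m → -[1+ k ℕ.+ m ] ℤ.+ (+ suc n ℤ.- + k) ≡ + n ℤ.- + (2 ℕ.* k ℕ.+ m)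
    exponent m = ≡.trans (≡.cong₂ (λ a b → ℤ.- a ℤ.+ (b ℤ.- + k))
                                  (≡.trans (ℤP.pos-+ 1 (k ℕ.+ m)) (≡.cong (ℤ._+_ (+ 1)) (ℤP.pos-+ k m))) (ℤP.pos-+ 1 n))
                         (≡.trans (shuffle (+ n) (+ k) (+ m))
                                  (≡.cong (ℤ._-_ (+ n)) (≡.sym (≡.trans (ℤP.pos-+ (2 ℕ.* k) m) (≡.cong (ℤ._+ + m) (ℤP.pos-* 2 k))))))
      where
      shuffle : ∀ n k m → ℤ.- (+ 1 ℤ.+ (k ℤ.+ m)) ℤ.+ ((+ 1 ℤ.+ n) ℤ.- k) ≡ n ℤ.- (+ 2 ℤ.* k ℤ.+ m)
      shuffle = solve-∀
    term : ∀ m → m ≤ j → ((1# - q) ^ m) * (fromℤ (binomℤ (+ n ℤ.- + (2 ℕ.* k ℕ.+ m)) (j ∸ m)) * fromℕ ((k ℕ.+ m) C m))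
                        ≈ α m * (shift m (g m) ⊛ h) j
    term m m≤j = begin
      ((1# - q) ^ m) * (fromℤ (binomℤ X (j ∸ m)) * fromℕ ((k ℕ.+ m) C m)) ≈⟨ *-congˡ (*-comm _ _) ⟩
      ((1# - q) ^ m) * (fromℕ ((k ℕ.+ m) C m) * fromℤ (binomℤ X (j ∸ m))) ≈⟨ *-assoc _ _ _ ⟨
      α m * fromℤ (binomℤ X (j ∸ m))            ≈⟨ *-congˡ (fromℤ-binomℤ X (j ∸ m)) ⟩
      α m * binomR X (j ∸ m)                    ≈⟨ *-congˡ ([1+1w]^ X (j ∸ m)) ⟨
      α m * ([1+ 1# w]^ X) (j ∸ m)              ≈⟨ *-congˡ ([1+w]^-≡ 1# (exponent m) (j ∸ m)) ⟨
      α m * ([1+ 1# w]^ (-[1+ k ℕ.+ m ] ℤ.+ (+ suc n ℤ.- + k))) (j ∸ m)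
                                                ≈⟨ *-congˡ ([1+w]^-+ 1# -[1+ k ℕ.+ m ] (+ suc n ℤ.- + k) (j ∸ m)) ⟨
      α m * (g m ⊛ h) (j ∸ m)                   ≈⟨ *-congˡ (≡⇒≈ (shift-below (g m ⊛ h) m≤j)) ⟨
      α m * shift m (g m ⊛ h) j                 ≈⟨ *-congˡ (shift-⊛ m (g m) h j) ⟨
      α m * (shift m (g m) ⊛ h) j               ∎
      where X = + n ℤ.- + (2 ℕ.* k ℕ.+ m)
    collapse : ∀ u → u ≤ j → Σ j (λ m → α m * shift m (g m) u) ≈ ([1+ q w]^ -[1+ k ]) u
    collapse u u≤j = begin
      Σ j (λ m → α m * shift m (g m) u)
        ≈⟨ Σ-truncate j _ u≤j (λ m u<m _ → trans (*-congˡ (≡⇒≈ (shift-above (g m) u<m))) (zeroʳ _)) ⟩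
      Σ u (λ m → α m * shift m (g m) u)
        ≈⟨ Σ-cong≤ u (λ m m≤u → *-congˡ (trans (≡⇒≈ (shift-below (g m) m≤u)) ([1+1w]^ -[1+ k ℕ.+ m ] (u ∸ m)))) ⟩
      Σ u (λ m → α m * binomR -[1+ k ℕ.+ m ] (u ∸ m))
        ≈⟨ negative-binomial-expansion q k u ⟩
      ([1+ q w]^ -[1+ k ]) u ∎

  H : Series
  H = [1+ q w]^ -[1+ 0 ] ⊛ [1+ 1# w]^ (+ suc n)

  innerSum-via-t : ∀ k r → k ≤ r → innerSum k (r ∸ k) ≈ (tPower k ⊛ H) r
  innerSum-via-t k r k≤r = begin
    innerSum k (r ∸ k)                                                  ≈⟨ innerSum-coefficient k (r ∸ k) ⟩
    ([1+ q w]^ -[1+ k ] ⊛ [1+ 1# w]^ (+ suc n ℤ.- + k)) (r ∸ k)         ≈⟨ product (r ∸ k) ⟨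
    (Φ (ℤ.- (+ k)) ⊛ H) (r ∸ k)                                         ≈⟨ ≡⇒≈ (shift-below (Φ (ℤ.- (+ k)) ⊛ H) k≤r) ⟨
    shift k (Φ (ℤ.- (+ k)) ⊛ H) r                                       ≈⟨ shift-⊛ k (Φ (ℤ.- (+ k))) H r ⟨
    (tPower k ⊛ H) r                                                    ∎
    where
    exponent : ∀ k → ℤ.- (+ k) ℤ.+ -[1+ 0 ] ≡ -[1+ k ]
    exponent k = ≡.trans (shuffle (+ k)) (≡.cong ℤ.-_ (≡.sym (ℤP.pos-+ 1 k)))
      where
      shuffle : ∀ k → ℤ.- k ℤ.+ ℤ.- (+ 1) ≡ ℤ.- (+ 1 ℤ.+ k)
      shuffle = solve-∀
    product : Φ (ℤ.- (+ k)) ⊛ H ≋ [1+ q w]^ -[1+ k ] ⊛ [1+ 1# w]^ (+ suc n ℤ.- + k)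
    product = ≋-trans (⊛-medial ([1+ q w]^ (ℤ.- (+ k))) ([1+ 1# w]^ (ℤ.- (+ k))) ([1+ q w]^ -[1+ 0 ]) ([1+ 1# w]^ (+ suc n)))
                (⊛-cong (≋-trans ([1+w]^-+ q (ℤ.- (+ k)) -[1+ 0 ]) ([1+w]^-≡ q (exponent k)))
                        (≋-trans ([1+w]^-+ 1# (ℤ.- (+ k)) (+ suc n)) ([1+w]^-≡ 1# (ℤP.+-comm (ℤ.- (+ k)) (+ suc n)))))

  [1+qw]H : ∀ r → ([1+ q w]^ (+ 1) ⊛ H) r ≈ fromℕ ((n ℕ.+ 1) C r)
  [1+qw]H r = begin
    ([1+ q w]^ (+ 1) ⊛ H) r                                         ≈⟨ ⊛-assoc ([1+ q w]^ (+ 1)) ([1+ q w]^ -[1+ 0 ]) ([1+ 1# w]^ (+ suc n)) r ⟨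
    (([1+ q w]^ (+ 1) ⊛ [1+ q w]^ -[1+ 0 ]) ⊛ [1+ 1# w]^ (+ suc n)) r
      ≈⟨ ⊛-congʳ ([1+ 1# w]^ (+ suc n)) (≋-trans ([1+w]^-+ q (+ 1) -[1+ 0 ]) ([1+w]^0 q)) r ⟩
    (𝟙 ⊛ [1+ 1# w]^ (+ suc n)) r                                    ≈⟨ ⊛-identityˡ ([1+ 1# w]^ (+ suc n)) r ⟩
    ([1+ 1# w]^ (+ suc n)) r                                        ≈⟨ [1+1w]^ (+ suc n) r ⟩
    fromℕ (suc n C r)                                               ≡⟨ ≡.cong (λ t → fromℕ (t C r)) (ℕP.+-comm 1 n) ⟩
    fromℕ ((n ℕ.+ 1) C r)                                           ∎

theorem5 : ∀ {c ℓ : Level} (R : CommutativeRing c ℓ) (q : CommutativeRing.Carrier R) (n r : ℕ) →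
    1 ≤ n → 1 ≤ r →
    let open CommutativeRing R
        open InRing R
    in sumFrom0 r (λ k → largeNarayana q k *
                 sumFrom0 (r ∸ k) (λ m → ((1# - q) ^ m) *
                    (fromℤ (binomℤ (+ n ℤ.- + (2 ℕ.* k ℕ.+ m)) (r ∸ k ∸ m)) *
                     fromℕ ((k ℕ.+ m) C m))))
       ≈ fromℕ ((n ℕ.+ 1) C r)
-- Steps 1–4 of the outline: rewrite each inner sum as [w^r] t^k H, pull the sum over k
-- inside the product, and evaluate Σ_k 𝒞_k(q) t^k = 1 + qw.
theorem5 R q n zero    _ ()
theorem5 R q n (suc r) _ _ = begin
  Σ (suc r) (λ k → largeNarayana q k * innerSum k (suc r ∸ k))
    ≈⟨ Σ-cong≤ (suc r) (λ k k≤r → *-congˡ (innerSum-via-t k (suc r) k≤r)) ⟩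
  Σ (suc r) (λ k → largeNarayana q k * (tPower k ⊛ H) (suc r))
    ≈⟨ Σ-⊛ (suc r) (largeNarayana q) tPower H (suc r) ⟩
  ((λ s → Σ (suc r) (λ k → largeNarayana q k * tPower k s)) ⊛ H) (suc r)
    ≈⟨ ⊛-cong-upto (suc r) H (narayana-at-t r) ⟩
  ([1+ q w]^ (+ 1) ⊛ H) (suc r)
    ≈⟨ [1+qw]H (suc r) ⟩
  fromℕ ((n ℕ.+ 1) C suc r) ∎
  where
  open CommutativeRing R hiding (zero)
  open InRing R
  open FiniteSums R using (Σ; Σ-cong≤)
  open PowerSeries R using (_⊛_; Σ-⊛; ⊛-cong-upto)
  open BinomialSeries R using ([1+_w]^_)
  open LagrangeInversion R q using (tPower; narayana-at-t)
  open InnerSum R q n using (innerSum; innerSum-via-t; H; [1+qw]H)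
  open import Relation.Binary.Reasoning.Setoid setoid
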